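{- Let $n$ be a positive integer. The number of pairs $(i,j)$ of nonnegative integers with $n=G_i+2G_j$ (i.e., the number of representations of $n$ as the sum of a generalized pentagonal number and twice a generalized pentagonal number) is odd if and only if $n$ is a triangular number, i.e., $n=m(m+1)/2$ for some integer $m\geq 0$.
   Context: For a nonnegative integer $n$, $T_n=n(n+1)/2$ and $G_n=T_n-T_{\lfloor n/2\rfloor}$ is the $n$th generalized pentagonal number; the sequence $G_0,G_1,G_2,\dots$ is $0,1,2,5,7,12,15,\dots$, listing each generalized pentagonal number (including $0$) exactly once. -}

module Defs where

open import Data.Nat using (ℕ; zero; suc; _+_; _*_; _/_)
open import Data.Nat.Properties using (_≟_)
open import Data.List using (List; length; filter; cartesianProduct; upTo)
open import Data.Product using (_×_; _,_; proj₁; proj₂)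
open import Relation.Binary.PropositionalEquality using (_≡_)

T : ℕ → ℕ
T n = (n * suc n) / 2

G : ℕ → ℕ
G n = T n Data.Nat.∸ T (n / 2)

-- Since G k ≥ k for all k, every pair (i , j) with G i + 2 G j = n
-- has i ≤ n and j ≤ n, so this list contains exactly all representations.
reps : ℕ → List (ℕ × ℕ)
reps n = filter (λ p → G (proj₁ p) + 2 * G (proj₂ p) ≟ n)
                (cartesianProduct (upTo (suc n)) (upTo (suc n)))

r : ℕ → ℕ
r n = length (reps n)

-- Since 24 G_i + 1 = p_i², where p_0, p_1, … are the positive integers prime to 6, the representations
-- n = G_i + 2 G_j are the solutions of x² + 2y² = 24n + 3 in positive integers prime to 3.  These are the
-- solutions with y = z of x² + 2yz = 24n + 3 in positive x, y, z not all divisible by 3, so by the involution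
-- (x, y, z) ↦ (x, z, y) they have the parity of all solutions.  A windmill involution in the style of Zagier
-- acts on the same solutions (as 24n + 3 ≡ 3 mod 8, no solution lies on a boundary of its regions) with the
-- triples (x, x, z) as fixed points, and these correspond to the divisors of 8n + 1 prime to 3.  Their number
-- is odd iff 8n + 1 or 3 (8n + 1) is a square; the latter is 3 mod 8, and 8n + 1 is a square iff n is triangular.

module Submission where

open import Defs
open import Data.Nat using (ℕ; suc; _%_)
open import Data.Product using (∃-syntax)
open import Relation.Binary.PropositionalEquality using (_≡_)
open import Function.Bundles using (_⇔_)

module Counting where

  open import Level using (Level)
  open import Data.Nat.Base using (ℕ; suc; _≤_; z≤n; s≤s; parity)
  open import Data.Parity.Base using (_⁻¹)
  open import Data.Parity.Properties using (+-homo-+)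
  open import Data.Nat.Properties using (≤-antisym; module ≤-Reasoning)
  open import Data.List.Base using (List; []; _∷_; length; filter; upTo)
  open import Data.List.Membership.Propositional using (_∈_; _∉_)
  open import Data.List.Relation.Unary.Any using (here; there)
  open import Data.List.Relation.Unary.AllPairs using (tail)
  open import Data.List.Relation.Unary.Unique.Propositional using (Unique)
  open import Data.List.Relation.Unary.Unique.Propositional.Properties using (Unique[x∷xs]⇒x∉xs; upTo⁺)
  open import Data.List.Membership.Propositional.Properties using (∈-upTo⁺)
  open import Data.Product.Base using (∃-syntax; _×_; _,_; proj₂)
  open import Function.Base using (_∘_)
  open import Relation.Binary.Definitions using (DecidableEquality)
  open import Relation.Binary.PropositionalEquality.Core using (_≡_; _≢_; refl; sym; trans; cong; subst)
  open import Relation.Binary.PropositionalEquality.Properties using (module ≡-Reasoning)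
  open import Relation.Nullary.Decidable using (yes; no; ¬?)
  open import Relation.Nullary.Negation using (¬_; contradiction)
  open import Relation.Unary using (Pred; Decidable)
  open import Relation.Unary.Properties using (_∩?_)

  private
    variable
      a b p q : Level
      A B : Set a

  parity-suc-cong : {m n : ℕ} → parity m ≡ parity n → parity (suc m) ≡ parity (suc n)
  parity-suc-cong {m} {n} eq = trans (+-homo-+ 1 m) (trans (cong _⁻¹ eq) (sym (+-homo-+ 1 n)))

  count : {P : Pred A p} → Decidable P → List A → ℕ
  count P? xs = length (filter P? xs)

  ∈-tail : {x y : A} {xs : List A} → x ∈ y ∷ xs → x ≢ y → x ∈ xs
  ∈-tail (here x≡y) x≢y = contradiction x≡y x≢y
  ∈-tail (there x∈) _   = x∈

  ∉⇒≢ : {x y : A} {xs : List A} → y ∉ xs → x ∈ xs → x ≢ y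
  ∉⇒≢ y∉ x∈ refl = y∉ x∈

  count-cong : {P : Pred A p} {Q : Pred A q} (P? : Decidable P) (Q? : Decidable Q) {xs : List A} →
               (∀ {x} → x ∈ xs → P x → Q x) → (∀ {x} → x ∈ xs → Q x → P x) →
               count P? xs ≡ count Q? xs
  count-cong P? Q? {[]}     P⇒Q Q⇒P = refl
  count-cong P? Q? {x ∷ xs} P⇒Q Q⇒P with P? x | Q? x
  ... | yes _  | yes _  = cong suc (count-cong P? Q? (P⇒Q ∘ there) (Q⇒P ∘ there))
  ... | no _   | no _   = count-cong P? Q? (P⇒Q ∘ there) (Q⇒P ∘ there)
  ... | yes Px | no ¬Qx = contradiction (P⇒Q (here refl) Px) ¬Qx
  ... | no ¬Px | yes Qx = contradiction (Q⇒P (here refl) Qx) ¬Px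

  count≡0 : {P : Pred A p} (P? : Decidable P) {xs : List A} → (∀ {x} → x ∈ xs → ¬ P x) → count P? xs ≡ 0
  count≡0 P? {[]}     ¬P = refl
  count≡0 P? {x ∷ xs} ¬P with P? x
  ... | yes Px = contradiction Px (¬P (here refl))
  ... | no _   = count≡0 P? (¬P ∘ there)

  count≢0⇒∃ : {P : Pred A p} (P? : Decidable P) {xs : List A} → count P? xs ≢ 0 → ∃[ x ] P x
  count≢0⇒∃ P? {[]}     c≢0 = contradiction refl c≢0
  count≢0⇒∃ P? {x ∷ xs} c≢0 with P? x
  ... | yes Px = x , Px
  ... | no _   = count≢0⇒∃ P? {xs} c≢0

  module _ {A : Set a} (_≟_ : DecidableEquality A) where

    count-remove : {P : Pred A p} (P? : Decidable P) {a : A} {xs : List A} →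
                   Unique xs → a ∈ xs → P a → count P? xs ≡ suc (count (P? ∩? (λ y → ¬? (y ≟ a))) xs)
    count-remove P? {a} {xs = x ∷ xs} u (here refl) Pa with P? a | a ≟ a
    ... | no ¬Pa | _        = contradiction Pa ¬Pa
    ... | yes _  | no a≢a   = contradiction refl a≢a
    ... | yes _  | yes _    =
      cong suc (count-cong P? (P? ∩? (λ y → ¬? (y ≟ a)))
                  (λ y∈ Py → Py , ∉⇒≢ (Unique[x∷xs]⇒x∉xs u) y∈) (λ _ (Py , _) → Py))
    count-remove P? {a} {xs = x ∷ xs} u (there a∈) Pa with P? x | x ≟ a
    ... | _     | yes refl = contradiction a∈ (Unique[x∷xs]⇒x∉xs u)
    ... | yes _ | no _     = cong suc (count-remove P? (tail u) a∈ Pa)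
    ... | no _  | no _     = count-remove P? (tail u) a∈ Pa

    parity-count-involution : {P : Pred A p} (P? : Decidable P) (f : A → A) {xs : List A} → Unique xs →
                       (∀ {x} → x ∈ xs → P x → f x ∈ xs × P (f x) × f (f x) ≡ x) →
                       parity (count P? xs) ≡ parity (count (P? ∩? λ x → f x ≟ x) xs)
    parity-count-involution P? f {[]} u inv = refl
    parity-count-involution {P = P} P? f {x ∷ xs} u inv with P? x
    ... | no ¬Px = parity-count-involution P? f (tail u) inv′
      where
      inv′ : ∀ {y} → y ∈ xs → P y → f y ∈ xs × P (f y) × f (f y) ≡ y
      inv′ y∈ Py with inv (there y∈) Py
      ... | fy∈ , Pfy , ffy = ∈-tail fy∈ (λ fy≡x → ¬Px (subst P fy≡x Pfy)) , Pfy , ffy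
    ... | yes Px with f x ≟ x
    ... | yes fx≡x = parity-suc-cong {count P? xs} {count (P? ∩? λ x → f x ≟ x) xs} (parity-count-involution P? f (tail u) inv′)
      where
      inv′ : ∀ {y} → y ∈ xs → P y → f y ∈ xs × P (f y) × f (f y) ≡ y
      inv′ y∈ Py with inv (there y∈) Py
      ... | fy∈ , Pfy , ffy =
        ∈-tail fy∈ (λ fy≡x → ∉⇒≢ (Unique[x∷xs]⇒x∉xs u) y∈ (trans (sym ffy) (trans (cong f fy≡x) fx≡x))) , Pfy , ffy
    ... | no fx≢x with inv (here refl) Px
    ... | fx∈ , Pfx , ffx = begin
      parity (suc (count P? xs))              ≡⟨ cong (parity ∘ suc) (count-remove P? (tail u) fx∈xs Pfx) ⟩
      parity (count P′? xs)                   ≡⟨ parity-count-involution P′? f (tail u) inv′ ⟩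
      parity (count (P′? ∩? fixed?) xs)       ≡⟨ cong parity (count-cong (P′? ∩? fixed?) (P? ∩? fixed?) {xs}
                                                    (λ _ ((Py , _) , fy≡y) → Py , fy≡y)
                                                    (λ _ (Py , fy≡y) → (Py , fixed≢fx fy≡y) , fy≡y)) ⟩
      parity (count (P? ∩? fixed?) xs)        ∎
      where
      open ≡-Reasoning
      fixed? = λ y → f y ≟ y
      P′? = P? ∩? (λ y → ¬? (y ≟ f x))
      x∉xs = Unique[x∷xs]⇒x∉xs u
      fx∈xs = ∈-tail fx∈ fx≢x
      fixed≢fx : ∀ {y} → f y ≡ y → y ≢ f x
      fixed≢fx fy≡y refl = fx≢x (trans (sym fy≡y) ffx)
      inv′ : ∀ {y} → y ∈ xs → P y × y ≢ f x → f y ∈ xs × (P (f y) × f y ≢ f x) × f (f y) ≡ y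
      inv′ y∈ (Py , y≢fx) with inv (there y∈) Py
      ... | fy∈ , Pfy , ffy =
        ∈-tail fy∈ (λ fy≡x → y≢fx (trans (sym ffy) (cong f fy≡x))) ,
        (Pfy , λ fy≡fx → ∉⇒≢ x∉xs y∈ (trans (sym ffy) (trans (cong f fy≡fx) ffx))) ,
        ffy

    count-injection : {B : Set b} {P : Pred B p} {Q : Pred A q} (P? : Decidable P) (Q? : Decidable Q)
                      (f : B → A) {xs : List B} {ys : List A} → Unique xs → Unique ys →
                      (∀ {x} → x ∈ xs → P x → f x ∈ ys × Q (f x)) →
                      (∀ {x x′} → x ∈ xs → x′ ∈ xs → P x → P x′ → f x ≡ f x′ → x ≡ x′) →
                      count P? xs ≤ count Q? ys
    count-injection P? Q? f {[]} _ _ _ _ = z≤n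
    count-injection {P = P} {Q = Q} P? Q? f {x ∷ xs} {ys} u v maps inj with P? x
    ... | no _ = count-injection P? Q? f (tail u) v (maps ∘ there) (λ x∈ x′∈ → inj (there x∈) (there x′∈))
    ... | yes Px with maps (here refl) Px
    ... | fx∈ , Qfx = begin
      suc (count P? xs)    ≤⟨ s≤s (count-injection P? Q′? f (tail u) v maps′ inj′) ⟩
      suc (count Q′? ys)   ≡⟨ count-remove Q? v fx∈ Qfx ⟨
      count Q? ys          ∎
      where
      open ≤-Reasoning
      Q′? = Q? ∩? (λ y → ¬? (y ≟ f x))
      inj′ : ∀ {y y′} → y ∈ xs → y′ ∈ xs → P y → P y′ → f y ≡ f y′ → y ≡ y′
      inj′ y∈ y′∈ = inj (there y∈) (there y′∈)
      maps′ : ∀ {y} → y ∈ xs → P y → f y ∈ ys × (Q (f y) × f y ≢ f x)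
      maps′ y∈ Py with maps (there y∈) Py
      ... | fy∈ , Qfy = fy∈ , Qfy , λ fy≡fx →
        ∉⇒≢ (Unique[x∷xs]⇒x∉xs u) y∈ (inj (there y∈) (here refl) Py Px fy≡fx)

  count-bijection : {A : Set a} {B : Set b} {P : Pred A p} {Q : Pred B q} →
                    DecidableEquality A → DecidableEquality B →
                    (P? : Decidable P) (Q? : Decidable Q) (f : A → B) (g : B → A)
                    {xs : List A} {ys : List B} → Unique xs → Unique ys →
                    (∀ {x} → x ∈ xs → P x → f x ∈ ys × Q (f x) × g (f x) ≡ x) →
                    (∀ {y} → y ∈ ys → Q y → g y ∈ xs × P (g y) × f (g y) ≡ y) →
                    count P? xs ≡ count Q? ys
  count-bijection {P = P} {Q = Q} _≟A_ _≟B_ P? Q? f g {xs} {ys} u v f-maps g-maps =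
    ≤-antisym (count-injection _≟B_ P? Q? f u v (λ x∈ Px → let (fx∈ , Qfx , _) = f-maps x∈ Px in fx∈ , Qfx) f-injective)
              (count-injection _≟A_ Q? P? g v u (λ y∈ Qy → let (gy∈ , Pgy , _) = g-maps y∈ Qy in gy∈ , Pgy) g-injective)
    where
    f-injective : ∀ {x x′} → x ∈ xs → x′ ∈ xs → P x → P x′ → f x ≡ f x′ → x ≡ x′
    f-injective x∈ x′∈ Px Px′ fx≡fx′ =
      trans (sym (proj₂ (proj₂ (f-maps x∈ Px)))) (trans (cong g fx≡fx′) (proj₂ (proj₂ (f-maps x′∈ Px′))))
    g-injective : ∀ {y y′} → y ∈ ys → y′ ∈ ys → Q y → Q y′ → g y ≡ g y′ → y ≡ y′
    g-injective y∈ y′∈ Qy Qy′ gy≡gy′ =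
      trans (sym (proj₂ (proj₂ (g-maps y∈ Qy)))) (trans (cong f gy≡gy′) (proj₂ (proj₂ (g-maps y′∈ Qy′))))

  box : ℕ → List ℕ
  box n = upTo (suc n)

  box-unique : ∀ n → Unique (box n)
  box-unique n = upTo⁺ (suc n)

  ∈-box : ∀ {n x} → x ≤ n → x ∈ box n
  ∈-box x≤n = ∈-upTo⁺ (s≤s x≤n)

module Arithmetic where

  open import Data.Nat.Base
  open import Data.Nat.Properties
    using (*-assoc; *-cancelˡ-≤; *-comm; *-mono-≤; +-comm; +-suc; 0≢1+n; <ᵇ⇒<; m≤n⇒∃[o]m+o≡n; suc-injective)
  open import Data.Nat.DivMod using (m*n/n≡m; m/n*n≡m; [m+kn]%n≡m%n; [m+n]%n≡m%n; m<n⇒m%n≡m; m<n⇒m/n≡0; +-distrib-/-∣ʳ)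
  open import Data.Nat.Divisibility using (_∣_; divides; divides-refl; ∣-trans; m∣m*n; n∣m*n; ∣⇒≤)
  open import Data.Nat.Primality using (Prime; prime?; euclidsLemma)
  open import Data.Nat.Tactic.RingSolver using (solve-∀)
  open import Data.Product.Base using (∃-syntax; _×_; _,_)
  open import Data.Sum.Base using (_⊎_; inj₁; inj₂; [_,_]′)
  open import Data.Unit.Base using (tt)
  open import Data.Parity.Base using (1ℙ)
  open import Function.Bundles using (_⇔_; mk⇔; Equivalence)
  open import Relation.Binary.PropositionalEquality using (_≡_; _≢_; refl; sym; trans; cong; cong₂; subst₂; module ≡-Reasoning)
  open import Relation.Nullary.Decidable using (toWitness)
  open import Relation.Nullary.Negation using (¬_; contradiction)
  open import Function.Base using (id)

  ≡⇒⇔≡ : ∀ {A : Set} {a b c : A} → a ≡ b → (a ≡ c ⇔ b ≡ c)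
  ≡⇒⇔≡ a≡b = mk⇔ (trans (sym a≡b)) (trans a≡b)

  ⊎-¬ʳ : ∀ {A B : Set} → ¬ B → (A ⊎ B) ⇔ A
  ⊎-¬ʳ ¬B = mk⇔ [ id , (λ b → contradiction b ¬B) ]′ inj₁

  even⊎odd : ∀ n → (∃[ t ] n ≡ t + t) ⊎ (∃[ t ] n ≡ suc (t + t))
  even⊎odd zero = inj₁ (0 , refl)
  even⊎odd (suc n) with even⊎odd n
  ... | inj₁ (t , refl) = inj₂ (t , refl)
  ... | inj₂ (t , refl) = inj₁ (suc t , cong suc (sym (+-suc t t)))

  odd≢even : ∀ a b → suc (a + a) ≢ b + b
  odd≢even zero    zero    ()
  odd≢even (suc a) zero    ()
  odd≢even zero    (suc b) e = 0≢1+n (trans (suc-injective e) (+-suc b b))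
  odd≢even (suc a) (suc b) e =
    odd≢even a b (suc-injective (trans (cong suc (sym (+-suc a a))) (trans (suc-injective e) (+-suc b b))))

  odd<odd⇒even-gap : ∀ {a b} → ∃[ u ] a ≡ suc (u + u) → ∃[ v ] b ≡ suc (v + v) → a < b → ∃[ e ] b ≡ a + 2 * suc e
  odd<odd⇒even-gap {a} {b} (u , refl) (v , refl) a<b with w , a+w≡ ← m≤n⇒∃[o]m+o≡n a<b | even⊎odd w
  ... | inj₁ (t , refl) = contradiction (trans (sym a+w≡) (gap-even u t)) (odd≢even v (suc (u + t)))
    where
    gap-even : ∀ u t → suc (suc (u + u)) + (t + t) ≡ suc (u + t) + suc (u + t)
    gap-even = solve-∀
  ... | inj₂ (e , refl) = e , trans (sym a+w≡) (gap-odd u e)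
    where
    gap-odd : ∀ u e → suc (suc (u + u)) + suc (e + e) ≡ suc (u + u) + 2 * suc e
    gap-odd = solve-∀

  odd-product⇒odd-factors : ∀ {m n} → ∃[ u ] m * n ≡ suc (u + u) → (∃[ v ] m ≡ suc (v + v)) × (∃[ w ] n ≡ suc (w + w))
  odd-product⇒odd-factors {m} {n} (u , mn≡) with even⊎odd m | even⊎odd n
  ... | inj₂ m-odd | inj₂ n-odd = m-odd , n-odd
  ... | inj₁ (t , refl) | _ = contradiction (trans (sym mn≡) (double-left t n)) (odd≢even u (t * n))
    where
    double-left : ∀ t n → (t + t) * n ≡ t * n + t * n
    double-left = solve-∀
  ... | inj₂ _ | inj₁ (t , refl) = contradiction (trans (sym mn≡) (double-right m t)) (odd≢even u (m * t))
    where
    double-right : ∀ m t → m * (t + t) ≡ m * t + m * t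
    double-right = solve-∀

  parity≡1ℙ⇔%2≡1 : ∀ n → parity n ≡ 1ℙ ⇔ n % 2 ≡ 1
  parity≡1ℙ⇔%2≡1 zero          = mk⇔ (λ ()) (λ ())
  parity≡1ℙ⇔%2≡1 (suc zero)    = mk⇔ (λ _ → refl) (λ _ → refl)
  parity≡1ℙ⇔%2≡1 (suc (suc n)) = mk⇔ (λ odd → trans [n+2]%2≡n%2 (Equivalence.to (parity≡1ℙ⇔%2≡1 n) odd))
                                     (λ n+2%2≡1 → Equivalence.from (parity≡1ℙ⇔%2≡1 n) (trans (sym [n+2]%2≡n%2) n+2%2≡1))
    where
    [n+2]%2≡n%2 : suc (suc n) % 2 ≡ n % 2
    [n+2]%2≡n%2 = trans (cong (_% 2) (+-comm 2 n)) ([m+n]%n≡m%n n 2)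

  remainder-unique : ∀ m {a c r s} .{{_ : NonZero m}} → r < m → s < m → m * a + r ≡ m * c + s → r ≡ s
  remainder-unique m {a} {c} {r} {s} r<m s<m e = begin
    r               ≡⟨ m<n⇒m%n≡m r<m ⟨
    r % m           ≡⟨ [m+kn]%n≡m%n r a m ⟨
    (r + a * m) % m ≡⟨ cong (_% m) (trans (+-comm r (a * m)) (trans (cong (_+ r) (*-comm a m)) e)) ⟩
    (m * c + s) % m ≡⟨ cong (_% m) (trans (+-comm (m * c) s) (cong (s +_) (*-comm m c))) ⟩
    (s + c * m) % m ≡⟨ [m+kn]%n≡m%n s c m ⟩
    s % m           ≡⟨ m<n⇒m%n≡m s<m ⟩
    s               ∎
    where open ≡-Reasoning

  [r+kn]/n≡k : ∀ r k n .{{_ : NonZero n}} → r < n → (r + k * n) / n ≡ k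
  [r+kn]/n≡k r k n r<n = begin
    (r + k * n) / n     ≡⟨ +-distrib-/-∣ʳ r (divides-refl k) ⟩
    r / n + k * n / n   ≡⟨ cong₂ _+_ (m<n⇒m/n≡0 r<n) (m*n/n≡m k n) ⟩
    k                   ∎
    where open ≡-Reasoning

  half-double : ∀ n → (2 * n) / 2 ≡ n
  half-double n = trans (cong (_/ 2) (*-comm 2 n)) (m*n/n≡m n 2)

  [t+t]/2≡t : ∀ t → (t + t) / 2 ≡ t
  [t+t]/2≡t t = trans (cong (_/ 2) (t+t≡0+t*2 t)) ([r+kn]/n≡k 0 t 2 (s≤s z≤n))
    where
    t+t≡0+t*2 : ∀ t → t + t ≡ 0 + t * 2
    t+t≡0+t*2 = solve-∀

  [1+t+t]/2≡t : ∀ t → suc (t + t) / 2 ≡ t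
  [1+t+t]/2≡t t = trans (cong (_/ 2) (1+t+t≡1+t*2 t)) ([r+kn]/n≡k 1 t 2 (s≤s (s≤s z≤n)))
    where
    1+t+t≡1+t*2 : ∀ t → suc (t + t) ≡ 1 + t * 2
    1+t+t≡1+t*2 = solve-∀

  3-prime : Prime 3
  3-prime = toWitness {a? = prime? 3} tt

  3∣2*n⇒3∣n : ∀ n → 3 ∣ 2 * n → 3 ∣ n
  3∣2*n⇒3∣n n 3∣2n with euclidsLemma 2 n 3-prime 3∣2n
  ... | inj₁ 3∣2 with s≤s (s≤s ()) ← ∣⇒≤ 3∣2
  ... | inj₂ 3∣n = 3∣n

  3∣n*n⇒3∣n : ∀ n → 3 ∣ n * n → 3 ∣ n
  3∣n*n⇒3∣n n 3∣n² with euclidsLemma n n 3-prime 3∣n²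
  ... | inj₁ 3∣n = 3∣n
  ... | inj₂ 3∣n = 3∣n

  2∣n*[1+n] : ∀ n → 2 ∣ n * suc n
  2∣n*[1+n] n with even⊎odd n
  ... | inj₁ (t , refl) = ∣-trans (divides t (t+t≡t*2 t)) (m∣m*n (suc (t + t)))
    where
    t+t≡t*2 : ∀ t → t + t ≡ t * 2
    t+t≡t*2 = solve-∀
  ... | inj₂ (t , refl) = ∣-trans (divides (suc t) (2+t+t≡[1+t]*2 t)) (n∣m*n (suc (t + t)))
    where
    2+t+t≡[1+t]*2 : ∀ t → suc (suc (t + t)) ≡ suc t * 2
    2+t+t≡[1+t]*2 = solve-∀

  2*T≡n*[1+n] : ∀ n → 2 * T n ≡ n * suc n
  2*T≡n*[1+n] n = trans (*-comm 2 (T n)) (m/n*n≡m (2∣n*[1+n] n))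

  T-mono-≤ : ∀ {m n} → m ≤ n → T m ≤ T n
  T-mono-≤ {m} {n} m≤n = *-cancelˡ-≤ 2 (subst₂ _≤_ (sym (2*T≡n*[1+n] m)) (sym (2*T≡n*[1+n] n)) (*-mono-≤ m≤n (s≤s m≤n)))

  odd-square : ∀ t → suc (t + t) * suc (t + t) ≡ 8 * T t + 1
  odd-square t = begin
    suc (t + t) * suc (t + t) ≡⟨ expand t ⟩
    4 * (t * suc t) + 1       ≡⟨ cong (λ w → 4 * w + 1) (2*T≡n*[1+n] t) ⟨
    4 * (2 * T t) + 1         ≡⟨ cong (_+ 1) (*-assoc 4 2 (T t)) ⟨
    8 * T t + 1               ∎
    where
    open ≡-Reasoning
    expand : ∀ t → suc (t + t) * suc (t + t) ≡ 4 * (t * suc t) + 1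
    expand = solve-∀

  8*a+1≢8*c+3 : ∀ a c → 8 * a + 1 ≢ 8 * c + 3
  8*a+1≢8*c+3 a c e with () ← remainder-unique 8 {a} {c} (<ᵇ⇒< 1 8 _) (<ᵇ⇒< 3 8 _) e

  8*a+7≢8*c+3 : ∀ a c → 8 * a + 7 ≢ 8 * c + 3
  8*a+7≢8*c+3 a c e with () ← remainder-unique 8 {a} {c} (<ᵇ⇒< 7 8 _) (<ᵇ⇒< 3 8 _) e

  4*a+1≢8*c+3 : ∀ a c → 4 * a + 1 ≢ 8 * c + 3
  4*a+1≢8*c+3 a c e with () ← remainder-unique 4 {a} {2 * c} (<ᵇ⇒< 1 4 _) (<ᵇ⇒< 3 4 _) (trans e (cong (_+ 3) (*-assoc 4 2 c)))

  square-odd⇒odd : ∀ {s m} → s * s ≡ suc (m + m) → ∃[ t ] s ≡ suc (t + t)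
  square-odd⇒odd {s} {m} s²≡ with even⊎odd s
  ... | inj₂ s-odd = s-odd
  ... | inj₁ (u , refl) = contradiction (trans (sym s²≡) (even-square u)) (odd≢even m (2 * (u * u)))
    where
    even-square : ∀ u → (u + u) * (u + u) ≡ 2 * (u * u) + 2 * (u * u)
    even-square = solve-∀

  square≢8*k+3 : ∀ s k → s * s ≢ 8 * k + 3
  square≢8*k+3 s k s²≡ with square-odd⇒odd {s} {4 * k + 1} (trans s²≡ (8k+3≡odd k))
    where
    8k+3≡odd : ∀ k → 8 * k + 3 ≡ suc ((4 * k + 1) + (4 * k + 1))
    8k+3≡odd = solve-∀
  ... | u , refl = 8*a+1≢8*c+3 (T u) k (trans (sym (odd-square u)) s²≡)

module Pentagonal where

  open import Data.Nat.Base
  open import Data.Nat.Properties using (*-cancelˡ-≤; *-distribˡ-+; +-cancelʳ-≡; +-suc; m∸n+n≡m; m≤m+n)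
  open import Data.Nat.DivMod using (m/n≤m; m≡m%n+[m/n]*n; m%n<n; [m+kn]%n≡m%n; m<n⇒m%n≡m)
  open import Data.Nat.Divisibility using (_∣_; n∣m⇒m%n≡0; m%n≡0⇒n∣m)
  open import Data.Nat.Tactic.RingSolver using (solve-∀)
  open import Data.Product.Base using (∃-syntax; _×_; _,_)
  open import Data.Sum.Base using (inj₁; inj₂)
  open import Relation.Binary.PropositionalEquality using (_≡_; _≢_; refl; sym; trans; cong; subst; module ≡-Reasoning)
  open import Relation.Nullary.Negation using (¬_; contradiction)
  open import Function.Base using (_∘_)
  open Arithmetic

  2*G+[n/2]*[1+n/2]≡n*[1+n] : ∀ n → 2 * G n + (n / 2) * suc (n / 2) ≡ n * suc n
  2*G+[n/2]*[1+n/2]≡n*[1+n] n = begin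
    2 * G n + (n / 2) * suc (n / 2) ≡⟨ cong (2 * G n +_) (2*T≡n*[1+n] (n / 2)) ⟨
    2 * G n + 2 * T (n / 2)         ≡⟨ *-distribˡ-+ 2 (G n) (T (n / 2)) ⟨
    2 * (G n + T (n / 2))           ≡⟨ cong (2 *_) (m∸n+n≡m (T-mono-≤ (m/n≤m n 2))) ⟩
    2 * T n                         ≡⟨ 2*T≡n*[1+n] n ⟩
    n * suc n                       ∎
    where open ≡-Reasoning

  2*G-even : ∀ t → 2 * G (t + t) + t * suc t ≡ (t + t) * suc (t + t)
  2*G-even t = subst (λ h → 2 * G (t + t) + h * suc h ≡ (t + t) * suc (t + t)) ([t+t]/2≡t t)
                     (2*G+[n/2]*[1+n/2]≡n*[1+n] (t + t))

  2*G-odd : ∀ t → 2 * G (suc (t + t)) + t * suc t ≡ suc (t + t) * suc (suc (t + t))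
  2*G-odd t = subst (λ h → 2 * G (suc (t + t)) + h * suc h ≡ suc (t + t) * suc (suc (t + t))) ([1+t+t]/2≡t t)
                    (2*G+[n/2]*[1+n/2]≡n*[1+n] (suc (t + t)))

  -- 1, 5, 7, 11, 13, …: the positive integers prime to 6, in increasing order.
  pentagonalRoot : ℕ → ℕ
  pentagonalRoot zero          = 1
  pentagonalRoot (suc zero)    = 5
  pentagonalRoot (suc (suc i)) = 6 + pentagonalRoot i

  pentagonalRoot-even : ∀ t → pentagonalRoot (t + t) ≡ 6 * t + 1
  pentagonalRoot-even zero = refl
  pentagonalRoot-even (suc t) rewrite +-suc t t = trans (cong (6 +_) (pentagonalRoot-even t)) (step t)
    where
    step : ∀ t → 6 + (6 * t + 1) ≡ 6 * suc t + 1
    step = solve-∀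

  pentagonalRoot-odd : ∀ t → pentagonalRoot (suc (t + t)) ≡ 6 * t + 5
  pentagonalRoot-odd zero = refl
  pentagonalRoot-odd (suc t) rewrite +-suc t t = trans (cong (6 +_) (pentagonalRoot-odd t)) (step t)
    where
    step : ∀ t → 6 + (6 * t + 5) ≡ 6 * suc t + 5
    step = solve-∀

  24*G+1≡pentagonalRoot² : ∀ i → 24 * G i + 1 ≡ pentagonalRoot i * pentagonalRoot i
  24*G+1≡pentagonalRoot² i with even⊎odd i
  ... | inj₁ (t , refl) = +-cancelʳ-≡ (12 * (t * suc t)) _ _ (begin
    24 * G (t + t) + 1 + 12 * (t * suc t)          ≡⟨ regroup t (G (t + t)) ⟩
    12 * (2 * G (t + t) + t * suc t) + 1           ≡⟨ cong (λ w → 12 * w + 1) (2*G-even t) ⟩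
    12 * ((t + t) * suc (t + t)) + 1               ≡⟨ complete-square t ⟩
    (6 * t + 1) * (6 * t + 1) + 12 * (t * suc t)   ≡⟨ cong (λ w → w * w + 12 * (t * suc t)) (pentagonalRoot-even t) ⟨
    pentagonalRoot (t + t) * pentagonalRoot (t + t) + 12 * (t * suc t) ∎)
    where
    open ≡-Reasoning
    complete-square : ∀ t → 12 * ((t + t) * suc (t + t)) + 1 ≡ (6 * t + 1) * (6 * t + 1) + 12 * (t * suc t)
    complete-square = solve-∀
    regroup : ∀ t g → 24 * g + 1 + 12 * (t * suc t) ≡ 12 * (2 * g + t * suc t) + 1
    regroup = solve-∀
  ... | inj₂ (t , refl) = +-cancelʳ-≡ (12 * (t * suc t)) _ _ (begin
    24 * G (suc (t + t)) + 1 + 12 * (t * suc t)    ≡⟨ regroup t (G (suc (t + t))) ⟩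
    12 * (2 * G (suc (t + t)) + t * suc t) + 1     ≡⟨ cong (λ w → 12 * w + 1) (2*G-odd t) ⟩
    12 * (suc (t + t) * suc (suc (t + t))) + 1     ≡⟨ complete-square t ⟩
    (6 * t + 5) * (6 * t + 5) + 12 * (t * suc t)   ≡⟨ cong (λ w → w * w + 12 * (t * suc t)) (pentagonalRoot-odd t) ⟨
    pentagonalRoot (suc (t + t)) * pentagonalRoot (suc (t + t)) + 12 * (t * suc t) ∎)
    where
    open ≡-Reasoning
    complete-square : ∀ t → 12 * (suc (t + t) * suc (suc (t + t))) + 1 ≡ (6 * t + 5) * (6 * t + 5) + 12 * (t * suc t)
    complete-square = solve-∀
    regroup : ∀ t g → 24 * g + 1 + 12 * (t * suc t) ≡ 12 * (2 * g + t * suc t) + 1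
    regroup = solve-∀

  pentagonalRoot≡r+3i : ∀ i → ∃[ r ] r < 3 × r ≢ 0 × pentagonalRoot i ≡ r + i * 3
  pentagonalRoot≡r+3i i with even⊎odd i
  ... | inj₁ (t , refl) = 1 , s≤s (s≤s z≤n) , (λ ()) , trans (pentagonalRoot-even t) (regroup t)
    where
    regroup : ∀ t → 6 * t + 1 ≡ 1 + (t + t) * 3
    regroup = solve-∀
  ... | inj₂ (t , refl) = 2 , s≤s (s≤s (s≤s z≤n)) , (λ ()) , trans (pentagonalRoot-odd t) (regroup t)
    where
    regroup : ∀ t → 6 * t + 5 ≡ 2 + suc (t + t) * 3
    regroup = solve-∀

  pentagonalRoot/3≡i : ∀ i → pentagonalRoot i / 3 ≡ i
  pentagonalRoot/3≡i i with r , r<3 , _ , e ← pentagonalRoot≡r+3i i = trans (cong (_/ 3) e) ([r+kn]/n≡k r i 3 r<3)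

  3∤pentagonalRoot : ∀ i → ¬ 3 ∣ pentagonalRoot i
  3∤pentagonalRoot i 3∣ with r , r<3 , r≢0 , e ← pentagonalRoot≡r+3i i = r≢0 (begin
    r                            ≡⟨ m<n⇒m%n≡m r<3 ⟨
    r % 3                        ≡⟨ [m+kn]%n≡m%n r i 3 ⟨
    (r + i * 3) % 3              ≡⟨ cong (_% 3) e ⟨
    pentagonalRoot i % 3         ≡⟨ n∣m⇒m%n≡0 _ 3 3∣ ⟩
    0                            ∎)
    where open ≡-Reasoning

  pentagonalRoot-positive : ∀ i → 1 ≤ pentagonalRoot i
  pentagonalRoot-positive zero          = s≤s z≤n
  pentagonalRoot-positive (suc zero)    = s≤s z≤n
  pentagonalRoot-positive (suc (suc i)) = s≤s z≤n

  pentagonalRoot-surjective : ∀ a → ¬ 3 ∣ a → ∃[ u ] a ≡ suc (u + u) → pentagonalRoot (a / 3) ≡ a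
  pentagonalRoot-surjective a 3∤a (u , a≡odd) =
    from-division (a % 3) (a / 3) (m≡m%n+[m/n]*n a 3) (m%n<n a 3) (3∤a ∘ m%n≡0⇒n∣m a 3)
    where
    from-division : ∀ r q → a ≡ r + q * 3 → r < 3 → r ≢ 0 → pentagonalRoot q ≡ a
    from-division 0 q _ _ r≢0 = contradiction refl r≢0
    from-division 1 q a≡ _ _ with even⊎odd q
    ... | inj₁ (t , refl) = trans (pentagonalRoot-even t) (trans (regroup t) (sym a≡))
      where
      regroup : ∀ t → 6 * t + 1 ≡ 1 + (t + t) * 3
      regroup = solve-∀
    ... | inj₂ (t , refl) = contradiction (trans (sym a≡odd) (trans a≡ (even t))) (odd≢even u (3 * t + 2))
      where
      even : ∀ t → 1 + suc (t + t) * 3 ≡ (3 * t + 2) + (3 * t + 2)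
      even = solve-∀
    from-division 2 q a≡ _ _ with even⊎odd q
    ... | inj₁ (t , refl) = contradiction (trans (sym a≡odd) (trans a≡ (even t))) (odd≢even u (3 * t + 1))
      where
      even : ∀ t → 2 + (t + t) * 3 ≡ (3 * t + 1) + (3 * t + 1)
      even = solve-∀
    ... | inj₂ (t , refl) = trans (pentagonalRoot-odd t) (trans (regroup t) (sym a≡))
      where
      regroup : ∀ t → 6 * t + 5 ≡ 2 + suc (t + t) * 3
      regroup = solve-∀
    from-division (suc (suc (suc r))) q _ (s≤s (s≤s (s≤s ()))) _

  n≤G : ∀ n → n ≤ G n
  n≤G n with even⊎odd n
  ... | inj₁ (zero , refl) = z≤n
  ... | inj₁ (suc u , refl) =
    *-cancelˡ-≤ 2 (subst (2 * (suc u + suc u) ≤_) (sym 2G≡) (m≤m+n _ _))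
    where
    expand : ∀ u → (suc u + suc u) * suc (suc u + suc u) ≡ (2 * (suc u + suc u) + (3 * (u * u) + 3 * u)) + suc u * suc (suc u)
    expand = solve-∀
    2G≡ : 2 * G (suc u + suc u) ≡ 2 * (suc u + suc u) + (3 * (u * u) + 3 * u)
    2G≡ = +-cancelʳ-≡ (suc u * suc (suc u)) _ _ (trans (2*G-even (suc u)) (expand u))
  ... | inj₂ (t , refl) =
    *-cancelˡ-≤ 2 (subst (2 * suc (t + t) ≤_) (sym 2G≡) (m≤m+n _ _))
    where
    expand : ∀ t → suc (t + t) * suc (suc (t + t)) ≡ (2 * suc (t + t) + (3 * (t * t) + t)) + t * suc t
    expand = solve-∀
    2G≡ : 2 * G (suc (t + t)) ≡ 2 * suc (t + t) + (3 * (t * t) + t)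
    2G≡ = +-cancelʳ-≡ (t * suc t) _ _ (trans (2*G-odd t) (expand t))

module Windmill where

  open import Data.Nat.Base using (ℕ; z<s)
  open import Data.Integer.Base using (ℤ; +_; +[1+_]; _+_; _*_; _-_; _<_; +<+)
  open import Data.Integer.Properties
    using (_<?_; <-cmp; <-asym; <-irrefl; i<j⇒suc[i]≤j; i≤j⇒0≤j-i; +-monoʳ-<; +-identityʳ; +-comm; *-cancelˡ-≡)
  open import Data.Integer.Tactic.RingSolver using (solve-∀)
  open import Data.Product.Base using (∃-syntax; _×_; _,_; proj₁; proj₂)
  open import Relation.Binary.Definitions using (tri<; tri≈; tri>)
  open import Relation.Binary.PropositionalEquality using (_≡_; _≢_; refl; sym; trans; cong; subst)
  open import Relation.Nullary.Decidable using (yes; no)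
  open import Relation.Nullary.Negation using (¬_; contradiction)

  Triple : Set
  Triple = ℤ × ℤ × ℤ

  Q : Triple → ℤ
  Q (x , y , z) = x * x + + 2 * (y * z)

  J₁ J₂ J₃ J₄ J₅ : Triple → Triple
  J₁ (x , y , z) = (x - + 2 * y , + 2 * x + z - + 2 * y , y)
  J₂ (x , y , z) = (+ 2 * y - x , y , z + + 2 * x - + 2 * y)
  J₃ (x , y , z) = (x + + 2 * z , z , y - + 2 * x - + 2 * z)
  J₄ (x , y , z) = (+ 3 * x + + 2 * z - + 2 * y , + 2 * x + + 2 * z - y , + 2 * y - + 2 * x - z)
  J₅ (x , y , z) = (+ 2 * y - + 3 * x - + 2 * z , + 2 * y - + 2 * x - z , + 2 * x + + 2 * z - y)

  J : Triple → Triple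
  J (x , y , z) with + 2 * y <? x
  ... | yes _ = J₁ (x , y , z)
  ... | no _ with + 2 * y <? z + + 2 * x
  ... | yes _ = J₂ (x , y , z)
  ... | no _ with + 2 * x + + 2 * z <? y
  ... | yes _ = J₃ (x , y , z)
  ... | no _ with + 2 * y <? + 3 * x + + 2 * z
  ... | yes _ = J₄ (x , y , z)
  ... | no _ = J₅ (x , y , z)

  module _ (x y z : ℤ) where

    J≡J₁ : + 2 * y < x → J (x , y , z) ≡ J₁ (x , y , z)
    J≡J₁ h with + 2 * y <? x
    ... | yes _ = refl
    ... | no ¬h = contradiction h ¬h

    J≡J₂ : ¬ + 2 * y < x → + 2 * y < z + + 2 * x → J (x , y , z) ≡ J₂ (x , y , z)
    J≡J₂ ¬h₁ h₂ with + 2 * y <? x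
    ... | yes h₁ = contradiction h₁ ¬h₁
    ... | no _ with + 2 * y <? z + + 2 * x
    ... | yes _ = refl
    ... | no ¬h₂ = contradiction h₂ ¬h₂

    J≡J₃ : ¬ + 2 * y < x → ¬ + 2 * y < z + + 2 * x → + 2 * x + + 2 * z < y → J (x , y , z) ≡ J₃ (x , y , z)
    J≡J₃ ¬h₁ ¬h₂ h₃ with + 2 * y <? x
    ... | yes h₁ = contradiction h₁ ¬h₁
    ... | no _ with + 2 * y <? z + + 2 * x
    ... | yes h₂ = contradiction h₂ ¬h₂
    ... | no _ with + 2 * x + + 2 * z <? y
    ... | yes _ = refl
    ... | no ¬h₃ = contradiction h₃ ¬h₃

    J≡J₄ : ¬ + 2 * y < x → ¬ + 2 * y < z + + 2 * x → ¬ + 2 * x + + 2 * z < y →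
           + 2 * y < + 3 * x + + 2 * z → J (x , y , z) ≡ J₄ (x , y , z)
    J≡J₄ ¬h₁ ¬h₂ ¬h₃ h₄ with + 2 * y <? x
    ... | yes h₁ = contradiction h₁ ¬h₁
    ... | no _ with + 2 * y <? z + + 2 * x
    ... | yes h₂ = contradiction h₂ ¬h₂
    ... | no _ with + 2 * x + + 2 * z <? y
    ... | yes h₃ = contradiction h₃ ¬h₃
    ... | no _ with + 2 * y <? + 3 * x + + 2 * z
    ... | yes _ = refl
    ... | no ¬h₄ = contradiction h₄ ¬h₄

    J≡J₅ : ¬ + 2 * y < x → ¬ + 2 * y < z + + 2 * x → ¬ + 2 * x + + 2 * z < y →
           ¬ + 2 * y < + 3 * x + + 2 * z → J (x , y , z) ≡ J₅ (x , y , z)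
    J≡J₅ ¬h₁ ¬h₂ ¬h₃ ¬h₄ with + 2 * y <? x
    ... | yes h₁ = contradiction h₁ ¬h₁
    ... | no _ with + 2 * y <? z + + 2 * x
    ... | yes h₂ = contradiction h₂ ¬h₂
    ... | no _ with + 2 * x + + 2 * z <? y
    ... | yes h₃ = contradiction h₃ ¬h₃
    ... | no _ with + 2 * y <? + 3 * x + + 2 * z
    ... | yes h₄ = contradiction h₄ ¬h₄
    ... | no _ = refl

  ≡-triple : {a b c a′ b′ c′ : ℤ} → a ≡ a′ → b ≡ b′ → c ≡ c′ → (a , b , c) ≡ (a′ , b′ , c′)
  ≡-triple refl refl refl = refl

  module _ (x y z : ℤ) where

    J₃∘J₁ : J₃ (J₁ (x , y , z)) ≡ (x , y , z)
    J₃∘J₁ = ≡-triple (coord₁ x y) refl (coord₃ x y z)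
      where
      coord₁ : ∀ x y → (x - + 2 * y) + + 2 * y ≡ x
      coord₁ = solve-∀
      coord₃ : ∀ x y z → + 2 * x + z - + 2 * y - + 2 * (x - + 2 * y) - + 2 * y ≡ z
      coord₃ = solve-∀

    J₁∘J₃ : J₁ (J₃ (x , y , z)) ≡ (x , y , z)
    J₁∘J₃ = ≡-triple (coord₁ x z) (coord₂ x y z) refl
      where
      coord₁ : ∀ x z → (x + + 2 * z) - + 2 * z ≡ x
      coord₁ = solve-∀
      coord₂ : ∀ x y z → + 2 * (x + + 2 * z) + (y - + 2 * x - + 2 * z) - + 2 * z ≡ y
      coord₂ = solve-∀

    J₂∘J₂ : J₂ (J₂ (x , y , z)) ≡ (x , y , z)
    J₂∘J₂ = ≡-triple (coord₁ x y) refl (coord₃ x y z)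
      where
      coord₁ : ∀ x y → + 2 * y - (+ 2 * y - x) ≡ x
      coord₁ = solve-∀
      coord₃ : ∀ x y z → (z + + 2 * x - + 2 * y) + + 2 * (+ 2 * y - x) - + 2 * y ≡ z
      coord₃ = solve-∀

    J₄∘J₄ : J₄ (J₄ (x , y , z)) ≡ (x , y , z)
    J₄∘J₄ = ≡-triple (coord₁ x y z) (coord₂ x y z) (coord₃ x y z)
      where
      coord₁ : ∀ x y z → + 3 * (+ 3 * x + + 2 * z - + 2 * y) + + 2 * (+ 2 * y - + 2 * x - z)
                       - + 2 * (+ 2 * x + + 2 * z - y) ≡ x
      coord₁ = solve-∀
      coord₂ : ∀ x y z → + 2 * (+ 3 * x + + 2 * z - + 2 * y) + + 2 * (+ 2 * y - + 2 * x - z)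
                       - (+ 2 * x + + 2 * z - y) ≡ y
      coord₂ = solve-∀
      coord₃ : ∀ x y z → + 2 * (+ 2 * x + + 2 * z - y) - + 2 * (+ 3 * x + + 2 * z - + 2 * y)
                       - (+ 2 * y - + 2 * x - z) ≡ z
      coord₃ = solve-∀

    J₅∘J₅ : J₅ (J₅ (x , y , z)) ≡ (x , y , z)
    J₅∘J₅ = ≡-triple (coord₁ x y z) (coord₂ x y z) (coord₃ x y z)
      where
      coord₁ : ∀ x y z → + 2 * (+ 2 * y - + 2 * x - z) - + 3 * (+ 2 * y - + 3 * x - + 2 * z)
                       - + 2 * (+ 2 * x + + 2 * z - y) ≡ x
      coord₁ = solve-∀
      coord₂ : ∀ x y z → + 2 * (+ 2 * y - + 2 * x - z) - + 2 * (+ 2 * y - + 3 * x - + 2 * z)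
                       - (+ 2 * x + + 2 * z - y) ≡ y
      coord₂ = solve-∀
      coord₃ : ∀ x y z → + 2 * (+ 2 * y - + 3 * x - + 2 * z) + + 2 * (+ 2 * x + + 2 * z - y)
                       - (+ 2 * y - + 2 * x - z) ≡ z
      coord₃ = solve-∀

  Q-J : ∀ t → Q (J t) ≡ Q t
  Q-J (x , y , z) with + 2 * y <? x
  ... | yes _ = Q-J₁ x y z
    where
    Q-J₁ : ∀ x y z → (x - + 2 * y) * (x - + 2 * y) + + 2 * ((+ 2 * x + z - + 2 * y) * y) ≡ x * x + + 2 * (y * z)
    Q-J₁ = solve-∀
  ... | no _ with + 2 * y <? z + + 2 * x
  ... | yes _ = Q-J₂ x y z
    where
    Q-J₂ : ∀ x y z → (+ 2 * y - x) * (+ 2 * y - x) + + 2 * (y * (z + + 2 * x - + 2 * y)) ≡ x * x + + 2 * (y * z)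
    Q-J₂ = solve-∀
  ... | no _ with + 2 * x + + 2 * z <? y
  ... | yes _ = Q-J₃ x y z
    where
    Q-J₃ : ∀ x y z → (x + + 2 * z) * (x + + 2 * z) + + 2 * (z * (y - + 2 * x - + 2 * z)) ≡ x * x + + 2 * (y * z)
    Q-J₃ = solve-∀
  ... | no _ with + 2 * y <? + 3 * x + + 2 * z
  ... | yes _ = Q-J₄ x y z
    where
    Q-J₄ : ∀ x y z → (+ 3 * x + + 2 * z - + 2 * y) * (+ 3 * x + + 2 * z - + 2 * y)
                     + + 2 * ((+ 2 * x + + 2 * z - y) * (+ 2 * y - + 2 * x - z)) ≡ x * x + + 2 * (y * z)
    Q-J₄ = solve-∀
  ... | no _ = Q-J₅ x y z
    where
    Q-J₅ : ∀ x y z → (+ 2 * y - + 3 * x - + 2 * z) * (+ 2 * y - + 3 * x - + 2 * z)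
                     + + 2 * ((+ 2 * y - + 2 * x - z) * (+ 2 * x + + 2 * z - y)) ≡ x * x + + 2 * (y * z)
    Q-J₅ = solve-∀

  infix 4 _≺_

  _≺_ : ℤ → ℤ → Set
  a ≺ b = ∃[ k ] b ≡ a + +[1+ k ]

  ≺⇒< : ∀ {a b} → a ≺ b → a < b
  ≺⇒< {a} (k , refl) = subst (_< a + +[1+ k ]) (+-identityʳ a) (+-monoʳ-< a (+<+ z<s))

  <⇒≺ : ∀ {a b} → a < b → a ≺ b
  <⇒≺ {a} {b} a<b with b - (+ 1 + a) | i≤j⇒0≤j-i (i<j⇒suc[i]≤j a<b) | split a b
    where
    split : ∀ a b → b ≡ (b - (+ 1 + a)) + (+ 1 + a)
    split = solve-∀
  ... | + k | _ | b≡k+1+a = k , trans b≡k+1+a (shift a (+ k))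
    where
    shift : ∀ a k → k + (+ 1 + a) ≡ a + (+ 1 + k)
    shift = solve-∀

  ≺-asym : ∀ {a b} → a ≺ b → ¬ b < a
  ≺-asym a≺b = <-asym (≺⇒< a≺b)

  ≺-irrefl : ∀ {a b} → a ≺ b → b ≢ a
  ≺-irrefl a≺b refl = <-irrefl refl (≺⇒< a≺b)

  -- A sum of terms +[1+ _] computes to some +[1+ _], so such sums are Positive by (_ , refl).
  Positive : ℤ → Set
  Positive a = ∃[ m ] a ≡ +[1+ m ]

  Positive³ : Triple → Set
  Positive³ (x , y , z) = Positive x × Positive y × Positive z

  positive-by : ∀ {a} d → a ≡ d → Positive d → Positive a
  positive-by d refl p = p

  ≺-by : ∀ {a b} d → b ≡ a + d → Positive d → a ≺ b
  ≺-by d e (k , refl) = k , e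

  record Step (t : Triple) : Set where
    field
      positive   : Positive³ (J t)
      involutive : J (J t) ≡ t
      fixed⇒x≡y  : J t ≡ t → proj₁ t ≡ proj₁ (proj₂ t)

  mkStep : ∀ {t u} → J t ≡ u → Positive³ u → J u ≡ t → (u ≡ t → proj₁ t ≡ proj₁ (proj₂ t)) → Step t
  mkStep refl pos inv fix = record { positive = pos ; involutive = inv ; fixed⇒x≡y = fix }

  [a+w]-a≡w : ∀ a w → (a + w) - a ≡ w
  [a+w]-a≡w = solve-∀

  step-J₁ : ∀ {x} b c → + 2 * +[1+ b ] ≺ x → Step (x , +[1+ b ] , +[1+ c ])
  step-J₁ b c (k , refl) =
    mkStep (J≡J₁ x B C (≺⇒< (k , refl)))
      (positive-by K (X≡K B K) (k , refl) , positive-by _ (Y≡2B+2K+C B K C) (_ , refl) , (b , refl))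
      (trans (J≡J₃ X Y Z (≺-asym (≺-by {X} {+ 2 * Y} _ (2Y≡X+ B K C) (_ , refl)))
                         (≺-asym (≺-by {Z + + 2 * X} {+ 2 * Y} _ (2Y≡Z+2X+ B K C) (_ , refl)))
                         (≺⇒< (≺-by {+ 2 * X + + 2 * Z} {Y} C (Y≡2X+2Z+ B K C) (c , refl))))
             (J₃∘J₁ x B C))
      (λ e → contradiction (trans (sym (cong proj₁ e)) (X≡K B K))
                           (≺-irrefl (≺-by {K} {x} (+ 2 * B) (x≡K+ B K) (_ , refl))))
    where
    B = +[1+ b ]
    K = +[1+ k ]
    C = +[1+ c ]
    x = + 2 * B + K
    X = proj₁ (J₁ (x , B , C))
    Y = proj₁ (proj₂ (J₁ (x , B , C)))
    Z = proj₂ (proj₂ (J₁ (x , B , C)))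
    X≡K : ∀ B K → (+ 2 * B + K) - + 2 * B ≡ K
    X≡K = solve-∀
    Y≡2B+2K+C : ∀ B K C → + 2 * (+ 2 * B + K) + C - + 2 * B ≡ + 2 * B + + 2 * K + C
    Y≡2B+2K+C = solve-∀
    2Y≡X+ : ∀ B K C → + 2 * (+ 2 * (+ 2 * B + K) + C - + 2 * B) ≡ ((+ 2 * B + K) - + 2 * B) + (+ 4 * B + + 3 * K + + 2 * C)
    2Y≡X+ = solve-∀
    2Y≡Z+2X+ : ∀ B K C → + 2 * (+ 2 * (+ 2 * B + K) + C - + 2 * B) ≡ (B + + 2 * ((+ 2 * B + K) - + 2 * B)) + (+ 3 * B + + 2 * K + + 2 * C)
    2Y≡Z+2X+ = solve-∀
    Y≡2X+2Z+ : ∀ B K C → + 2 * (+ 2 * B + K) + C - + 2 * B ≡ (+ 2 * ((+ 2 * B + K) - + 2 * B) + + 2 * B) + C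
    Y≡2X+2Z+ = solve-∀
    x≡K+ : ∀ B K → + 2 * B + K ≡ K + + 2 * B
    x≡K+ = solve-∀

  step-J₂ : ∀ a b c → +[1+ a ] ≺ + 2 * +[1+ b ] → + 2 * +[1+ b ] ≺ +[1+ c ] + + 2 * +[1+ a ] →
            Step (+[1+ a ] , +[1+ b ] , +[1+ c ])
  step-J₂ a b c (m , h₁) (n , h₂) =
    mkStep (J≡J₂ x y z (≺-asym (m , h₁)) (≺⇒< (n , h₂)))
      (positive-by +[1+ m ] (trans (cong (_- x) h₁) ([a+w]-a≡w x +[1+ m ])) (m , refl) ,
       (b , refl) ,
       positive-by +[1+ n ] (trans (cong (_- + 2 * y) h₂) ([a+w]-a≡w (+ 2 * y) +[1+ n ])) (n , refl))
      (trans (J≡J₂ X Y Z (≺-asym (≺-by {X} {+ 2 * Y} x (2Y≡X+ x y) (a , refl)))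
                         (≺⇒< (≺-by {+ 2 * Y} {Z + + 2 * X} z (Z+2X≡2Y+ x y z) (c , refl))))
             (J₂∘J₂ x y z))
      (λ e → sym (*-cancelˡ-≡ (+ 2) y x (X≡x⇒2y≡2x x y (cong proj₁ e))))
    where
    x = +[1+ a ]
    y = +[1+ b ]
    z = +[1+ c ]
    X = proj₁ (J₂ (x , y , z))
    Y = proj₁ (proj₂ (J₂ (x , y , z)))
    Z = proj₂ (proj₂ (J₂ (x , y , z)))
    2Y≡X+ : ∀ x y → + 2 * y ≡ (+ 2 * y - x) + x
    2Y≡X+ = solve-∀
    Z+2X≡2Y+ : ∀ x y z → (z + + 2 * x - + 2 * y) + + 2 * (+ 2 * y - x) ≡ + 2 * y + z
    Z+2X≡2Y+ = solve-∀
    X≡x⇒2y≡2x : ∀ x y → + 2 * y - x ≡ x → + 2 * y ≡ + 2 * x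
    X≡x⇒2y≡2x x y e = trans (sym (sub-add x y)) (trans (cong (_+ x) e) (double x))
      where
      sub-add : ∀ x y → (+ 2 * y - x) + x ≡ + 2 * y
      sub-add = solve-∀
      double : ∀ x → x + x ≡ + 2 * x
      double = solve-∀

  step-J₃ : ∀ {y} a c → + 2 * +[1+ a ] + + 2 * +[1+ c ] ≺ y → Step (+[1+ a ] , y , +[1+ c ])
  step-J₃ a c (k , refl) =
    mkStep (J≡J₃ A y C (≺-asym (≺-by {A} {+ 2 * y} _ (2y≡A+ A C K) (_ , refl)))
                       (≺-asym (≺-by {C + + 2 * A} {+ 2 * y} _ (2y≡C+2A+ A C K) (_ , refl)))
                       (≺⇒< (k , refl)))
      ((_ , refl) , (c , refl) , positive-by K (Z≡K A C K) (k , refl))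
      (trans (J≡J₁ X Y Z (≺⇒< (≺-by {+ 2 * Y} {X} A (X≡2Y+ A C) (a , refl)))) (J₁∘J₃ A y C))
      (λ e → contradiction (cong proj₁ e) (≺-irrefl (≺-by {A} {A + + 2 * C} (+ 2 * C) refl (_ , refl))))
    where
    A = +[1+ a ]
    C = +[1+ c ]
    K = +[1+ k ]
    y = + 2 * A + + 2 * C + K
    X = proj₁ (J₃ (A , y , C))
    Y = proj₁ (proj₂ (J₃ (A , y , C)))
    Z = proj₂ (proj₂ (J₃ (A , y , C)))
    2y≡A+ : ∀ A C K → + 2 * (+ 2 * A + + 2 * C + K) ≡ A + (+ 3 * A + + 4 * C + + 2 * K)
    2y≡A+ = solve-∀
    2y≡C+2A+ : ∀ A C K → + 2 * (+ 2 * A + + 2 * C + K) ≡ (C + + 2 * A) + (+ 2 * A + + 3 * C + + 2 * K)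
    2y≡C+2A+ = solve-∀
    Z≡K : ∀ A C K → (+ 2 * A + + 2 * C + K) - + 2 * A - + 2 * C ≡ K
    Z≡K = solve-∀
    X≡2Y+ : ∀ A C → A + + 2 * C ≡ + 2 * C + A
    X≡2Y+ = solve-∀

  module _ (a b c : ℕ) where

    private
      x = +[1+ a ]
      y = +[1+ b ]
      z = +[1+ c ]
      2y≮x : ∀ {m} → + 2 * y ≡ (z + + 2 * x) + +[1+ m ] → ¬ + 2 * y < x
      2y≮x {m} h = ≺-asym (≺-by {x} {+ 2 * y} (z + x + +[1+ m ]) (trans h (regroup x z +[1+ m ])) (_ , refl))
        where
        regroup : ∀ x z w → (z + + 2 * x) + w ≡ x + (z + x + w)
        regroup = solve-∀
      Z≡w : ∀ x z w → ((z + + 2 * x) + w) - + 2 * x - z ≡ w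
      Z≡w = solve-∀

    step-J₄ : z + + 2 * x ≺ + 2 * y → y ≺ + 2 * x + + 2 * z → + 2 * y ≺ + 3 * x + + 2 * z → y ≢ x + z →
              Step (x , y , z)
    step-J₄ (m , h₁) (n , h₂) (p , h₃) y≢x+z =
      mkStep (J≡J₄ x y z (2y≮x h₁) (≺-asym (m , h₁)) (≺-asym (n , h₂)) (≺⇒< (p , h₃)))
        (positive-by +[1+ p ] (trans (cong (_- + 2 * y) h₃) ([a+w]-a≡w (+ 2 * y) +[1+ p ])) (p , refl) ,
         positive-by +[1+ n ] (trans (cong (_- y) h₂) ([a+w]-a≡w y +[1+ n ])) (n , refl) ,
         positive-by +[1+ m ] (trans (cong (λ w → w - + 2 * x - z) h₁) (Z≡w x z +[1+ m ])) (m , refl))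
        (trans (J≡J₄ X Y Z (≺-asym (≺-by {X} {+ 2 * Y} (x + + 2 * z) (2Y≡X+ x y z) (_ , refl)))
                           (≺-asym (≺-by {Z + + 2 * X} {+ 2 * Y} z (2Y≡Z+2X+ x y z) (c , refl)))
                           (≺-asym (≺-by {Y} {+ 2 * X + + 2 * Z} y (2X+2Z≡Y+ x y z) (b , refl)))
                           (≺⇒< (≺-by {+ 2 * Y} {+ 3 * X + + 2 * Z} x (3X+2Z≡2Y+ x y z) (a , refl))))
               (J₄∘J₄ x y z))
        (λ e → contradiction (*-cancelˡ-≡ (+ 2) y (x + z)
                                (trans (2y≡3x+2z-X x y z) (trans (cong (+ 3 * x + + 2 * z -_) (cong proj₁ e)) (3x+2z-x≡2[x+z] x z))))
                             y≢x+z)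
      where
      X = proj₁ (J₄ (x , y , z))
      Y = proj₁ (proj₂ (J₄ (x , y , z)))
      Z = proj₂ (proj₂ (J₄ (x , y , z)))
      2Y≡X+ : ∀ x y z → + 2 * (+ 2 * x + + 2 * z - y) ≡ (+ 3 * x + + 2 * z - + 2 * y) + (x + + 2 * z)
      2Y≡X+ = solve-∀
      2Y≡Z+2X+ : ∀ x y z → + 2 * (+ 2 * x + + 2 * z - y) ≡ ((+ 2 * y - + 2 * x - z) + + 2 * (+ 3 * x + + 2 * z - + 2 * y)) + z
      2Y≡Z+2X+ = solve-∀
      2X+2Z≡Y+ : ∀ x y z → + 2 * (+ 3 * x + + 2 * z - + 2 * y) + + 2 * (+ 2 * y - + 2 * x - z) ≡ (+ 2 * x + + 2 * z - y) + y
      2X+2Z≡Y+ = solve-∀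
      3X+2Z≡2Y+ : ∀ x y z → + 3 * (+ 3 * x + + 2 * z - + 2 * y) + + 2 * (+ 2 * y - + 2 * x - z) ≡ + 2 * (+ 2 * x + + 2 * z - y) + x
      3X+2Z≡2Y+ = solve-∀
      2y≡3x+2z-X : ∀ x y z → + 2 * y ≡ (+ 3 * x + + 2 * z) - (+ 3 * x + + 2 * z - + 2 * y)
      2y≡3x+2z-X = solve-∀
      3x+2z-x≡2[x+z] : ∀ x z → (+ 3 * x + + 2 * z) - x ≡ + 2 * (x + z)
      3x+2z-x≡2[x+z] = solve-∀

    step-J₅ : z + + 2 * x ≺ + 2 * y → y ≺ + 2 * x + + 2 * z → + 3 * x + + 2 * z ≺ + 2 * y → y ≢ + 2 * x + z →
              Step (x , y , z)
    step-J₅ (m , h₁) (n , h₂) (p , h₄) y≢2x+z =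
      mkStep (J≡J₅ x y z (2y≮x h₁) (≺-asym (m , h₁)) (≺-asym (n , h₂)) (≺-asym (p , h₄)))
        (positive-by +[1+ p ] X≡p (p , refl) ,
         positive-by +[1+ m ] (trans (cong (λ w → w - + 2 * x - z) h₁) (Z≡w x z +[1+ m ])) (m , refl) ,
         positive-by +[1+ n ] (trans (cong (_- y) h₂) ([a+w]-a≡w y +[1+ n ])) (n , refl))
        (trans (J≡J₅ X Y Z (≺-asym (≺-by {X} {+ 2 * Y} (+[1+ p ] + (+ 2 * x + + 2 * z))
                                     (trans (2Y≡X+ x y z) (cong (λ w → X + (w + (+ 2 * x + + 2 * z))) X≡p)) (_ , refl)))
                           (≺-asym (≺-by {Z + + 2 * X} {+ 2 * Y} y (2Y≡Z+2X+ x y z) (b , refl)))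
                           (≺-asym (≺-by {Y} {+ 2 * X + + 2 * Z} z (2X+2Z≡Y+ x y z) (c , refl)))
                           (≺-asym (≺-by {+ 3 * X + + 2 * Z} {+ 2 * Y} x (2Y≡3X+2Z+ x y z) (a , refl))))
               (J₅∘J₅ x y z))
        (λ e → contradiction (*-cancelˡ-≡ (+ 2) y (+ 2 * x + z)
                                (trans (2y≡X+3x+2z x y z) (trans (cong (_+ (+ 3 * x + + 2 * z)) (cong proj₁ e)) (x+3x+2z≡2[2x+z] x z))))
                             y≢2x+z)
      where
      X = proj₁ (J₅ (x , y , z))
      Y = proj₁ (proj₂ (J₅ (x , y , z)))
      Z = proj₂ (proj₂ (J₅ (x , y , z)))
      X≡w : ∀ x z w → ((+ 3 * x + + 2 * z) + w) - + 3 * x - + 2 * z ≡ w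
      X≡w = solve-∀
      X≡p : X ≡ +[1+ p ]
      X≡p = trans (cong (λ w → w - + 3 * x - + 2 * z) h₄) (X≡w x z +[1+ p ])
      2Y≡X+ : ∀ x y z → + 2 * (+ 2 * y - + 2 * x - z) ≡ (+ 2 * y - + 3 * x - + 2 * z) + ((+ 2 * y - + 3 * x - + 2 * z) + (+ 2 * x + + 2 * z))
      2Y≡X+ = solve-∀
      2Y≡Z+2X+ : ∀ x y z → + 2 * (+ 2 * y - + 2 * x - z) ≡ ((+ 2 * x + + 2 * z - y) + + 2 * (+ 2 * y - + 3 * x - + 2 * z)) + y
      2Y≡Z+2X+ = solve-∀
      2X+2Z≡Y+ : ∀ x y z → + 2 * (+ 2 * y - + 3 * x - + 2 * z) + + 2 * (+ 2 * x + + 2 * z - y) ≡ (+ 2 * y - + 2 * x - z) + z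
      2X+2Z≡Y+ = solve-∀
      2Y≡3X+2Z+ : ∀ x y z → + 2 * (+ 2 * y - + 2 * x - z) ≡ (+ 3 * (+ 2 * y - + 3 * x - + 2 * z) + + 2 * (+ 2 * x + + 2 * z - y)) + x
      2Y≡3X+2Z+ = solve-∀
      2y≡X+3x+2z : ∀ x y z → + 2 * y ≡ (+ 2 * y - + 3 * x - + 2 * z) + (+ 3 * x + + 2 * z)
      2y≡X+3x+2z = solve-∀
      x+3x+2z≡2[2x+z] : ∀ x z → x + (+ 3 * x + + 2 * z) ≡ + 2 * (+ 2 * x + z)
      x+3x+2z≡2[2x+z] = solve-∀

  -- The boundaries between the regions of J, and the lines on which J₄ and J₅ have fixed points.
  record NonDegenerate (t : Triple) : Set where
    field
      2y≢x      : let (x , y , z) = t in + 2 * y ≢ x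
      2y≢z+2x   : let (x , y , z) = t in + 2 * y ≢ z + + 2 * x
      2x+2z≢y   : let (x , y , z) = t in + 2 * x + + 2 * z ≢ y
      2y≢3x+2z  : let (x , y , z) = t in + 2 * y ≢ + 3 * x + + 2 * z
      y≢x+z     : let (x , y , z) = t in y ≢ x + z
      y≢2x+z    : let (x , y , z) = t in y ≢ + 2 * x + z

  open NonDegenerate

  step : ∀ a b c → NonDegenerate (+[1+ a ] , +[1+ b ] , +[1+ c ]) → Step (+[1+ a ] , +[1+ b ] , +[1+ c ])
  step a b c nd with <-cmp (+ 2 * +[1+ b ]) +[1+ a ]
  ... | tri< lt _ _ = step-J₁ b c (<⇒≺ lt)
  ... | tri≈ _ eq _ = contradiction eq (2y≢x nd)
  ... | tri> _ _ gt with <-cmp (+ 2 * +[1+ b ]) (+[1+ c ] + + 2 * +[1+ a ])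
  ...   | tri< lt _ _ = step-J₂ a b c (<⇒≺ gt) (<⇒≺ lt)
  ...   | tri≈ _ eq _ = contradiction eq (2y≢z+2x nd)
  ...   | tri> _ _ gt₂ with <-cmp (+ 2 * +[1+ a ] + + 2 * +[1+ c ]) +[1+ b ]
  ...     | tri< lt _ _ = step-J₃ a c (<⇒≺ lt)
  ...     | tri≈ _ eq _ = contradiction eq (2x+2z≢y nd)
  ...     | tri> _ _ gt₃ with <-cmp (+ 2 * +[1+ b ]) (+ 3 * +[1+ a ] + + 2 * +[1+ c ])
  ...       | tri< lt _ _ = step-J₄ a b c (<⇒≺ gt₂) (<⇒≺ gt₃) (<⇒≺ lt) (y≢x+z nd)
  ...       | tri≈ _ eq _ = contradiction eq (2y≢3x+2z nd)
  ...       | tri> _ _ gt₄ = step-J₅ a b c (<⇒≺ gt₂) (<⇒≺ gt₃) (<⇒≺ gt₄) (y≢2x+z nd)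

  J-fixes-x=y : ∀ a c → J (+[1+ a ] , +[1+ a ] , +[1+ c ]) ≡ (+[1+ a ] , +[1+ a ] , +[1+ c ])
  J-fixes-x=y a c =
    trans (J≡J₂ A A C (≺-asym (≺-by {A} {+ 2 * A} A (double A) (a , refl)))
                      (≺⇒< (≺-by {+ 2 * A} {C + + 2 * A} C (+-comm C (+ 2 * A)) (c , refl))))
          (≡-triple (e₁ A) refl (e₃ A C))
    where
    A = +[1+ a ]
    C = +[1+ c ]
    double : ∀ A → + 2 * A ≡ A + A
    double = solve-∀
    e₁ : ∀ A → + 2 * A - A ≡ A
    e₁ = solve-∀
    e₃ : ∀ A C → C + + 2 * A - + 2 * A ≡ C
    e₃ = solve-∀

  Multiple³ : Triple → Set
  Multiple³ (x , y , z) = (∃[ u ] x ≡ + 3 * u) × (∃[ v ] y ≡ + 3 * v) × (∃[ w ] z ≡ + 3 * w)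

  J-preserves-multiples-of-3 : ∀ u v w → Multiple³ (J (+ 3 * u , + 3 * v , + 3 * w))
  J-preserves-multiples-of-3 u v w with + 2 * (+ 3 * v) <? + 3 * u
  ... | yes _ = (_ , m₁₁ u v) , (_ , m₁₂ u v w) , (v , refl)
    where
    m₁₁ : ∀ u v → + 3 * u - + 2 * (+ 3 * v) ≡ + 3 * (u - + 2 * v)
    m₁₁ = solve-∀
    m₁₂ : ∀ u v w → + 2 * (+ 3 * u) + + 3 * w - + 2 * (+ 3 * v) ≡ + 3 * (+ 2 * u + w - + 2 * v)
    m₁₂ = solve-∀
  ... | no _ with + 2 * (+ 3 * v) <? + 3 * w + + 2 * (+ 3 * u)
  ... | yes _ = (_ , m₂₁ u v) , (v , refl) , (_ , m₂₃ u v w)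
    where
    m₂₁ : ∀ u v → + 2 * (+ 3 * v) - + 3 * u ≡ + 3 * (+ 2 * v - u)
    m₂₁ = solve-∀
    m₂₃ : ∀ u v w → + 3 * w + + 2 * (+ 3 * u) - + 2 * (+ 3 * v) ≡ + 3 * (w + + 2 * u - + 2 * v)
    m₂₃ = solve-∀
  ... | no _ with + 2 * (+ 3 * u) + + 2 * (+ 3 * w) <? + 3 * v
  ... | yes _ = (_ , m₃₁ u w) , (w , refl) , (_ , m₃₃ u v w)
    where
    m₃₁ : ∀ u w → + 3 * u + + 2 * (+ 3 * w) ≡ + 3 * (u + + 2 * w)
    m₃₁ = solve-∀
    m₃₃ : ∀ u v w → + 3 * v - + 2 * (+ 3 * u) - + 2 * (+ 3 * w) ≡ + 3 * (v - + 2 * u - + 2 * w)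
    m₃₃ = solve-∀
  ... | no _ with + 2 * (+ 3 * v) <? + 3 * (+ 3 * u) + + 2 * (+ 3 * w)
  ... | yes _ = (_ , m₄₁ u v w) , (_ , m₄₂ u v w) , (_ , m₄₃ u v w)
    where
    m₄₁ : ∀ u v w → + 3 * (+ 3 * u) + + 2 * (+ 3 * w) - + 2 * (+ 3 * v) ≡ + 3 * (+ 3 * u + + 2 * w - + 2 * v)
    m₄₁ = solve-∀
    m₄₂ : ∀ u v w → + 2 * (+ 3 * u) + + 2 * (+ 3 * w) - + 3 * v ≡ + 3 * (+ 2 * u + + 2 * w - v)
    m₄₂ = solve-∀
    m₄₃ : ∀ u v w → + 2 * (+ 3 * v) - + 2 * (+ 3 * u) - + 3 * w ≡ + 3 * (+ 2 * v - + 2 * u - w)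
    m₄₃ = solve-∀
  ... | no _ = (_ , m₅₁ u v w) , (_ , m₅₂ u v w) , (_ , m₅₃ u v w)
    where
    m₅₁ : ∀ u v w → + 2 * (+ 3 * v) - + 3 * (+ 3 * u) - + 2 * (+ 3 * w) ≡ + 3 * (+ 2 * v - + 3 * u - + 2 * w)
    m₅₁ = solve-∀
    m₅₂ : ∀ u v w → + 2 * (+ 3 * v) - + 2 * (+ 3 * u) - + 3 * w ≡ + 3 * (+ 2 * v - + 2 * u - w)
    m₅₂ = solve-∀
    m₅₃ : ∀ u v w → + 2 * (+ 3 * u) + + 2 * (+ 3 * w) - + 3 * v ≡ + 3 * (+ 2 * u + + 2 * w - v)
    m₅₃ = solve-∀

module QuadraticForm where

  open import Data.Nat.Base
  open import Data.Nat.Properties using (*-assoc; +-comm)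
  open import Data.Nat.Divisibility using (_∣_; divides; ∣m+n∣m⇒∣n; m∣m*n)
  open import Data.Nat.Tactic.RingSolver using (solve-∀)
  open import Data.Product.Base using (∃-syntax; _×_; _,_)
  open import Data.Sum.Base using (inj₁; inj₂)
  open import Relation.Binary.PropositionalEquality using (_≡_; _≢_; refl; sym; trans; cong; subst; module ≡-Reasoning)
  open import Relation.Nullary.Negation using (contradiction)
  open Arithmetic

  ℕ³ : Set
  ℕ³ = ℕ × ℕ × ℕ

  Q : ℕ³ → ℕ
  Q (x , y , z) = x * x + 2 * (y * z)

  module Q≡8k+3⇒ {x y z k : ℕ} (Q≡8k+3 : Q (x , y , z) ≡ 8 * k + 3) where

    x-odd : ∃[ t ] x ≡ suc (t + t)
    x-odd with even⊎odd x
    ... | inj₂ odd = odd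
    ... | inj₁ (t , refl) = contradiction (trans (sym (8k+3≡odd k)) (trans (sym Q≡8k+3) (Q≡even t y z)))
                                          (odd≢even (4 * k + 1) (2 * (t * t) + y * z))
      where
      Q≡even : ∀ t y z → (t + t) * (t + t) + 2 * (y * z) ≡ (2 * (t * t) + y * z) + (2 * (t * t) + y * z)
      Q≡even = solve-∀
      8k+3≡odd : ∀ k → 8 * k + 3 ≡ suc ((4 * k + 1) + (4 * k + 1))
      8k+3≡odd = solve-∀

    2y≢x : 2 * y ≢ x
    2y≢x 2y≡x with x-odd
    ... | t , refl = odd≢even t y (trans (sym 2y≡x) (double y))
      where
      double : ∀ y → 2 * y ≡ y + y
      double = solve-∀

    2y≢z+2x : 2 * y ≢ z + 2 * x
    2y≢z+2x 2y≡z+2x = square≢8*k+3 (x + z) k (begin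
      (x + z) * (x + z)           ≡⟨ square x z ⟩
      x * x + (z + 2 * x) * z     ≡⟨ cong (λ w → x * x + w * z) 2y≡z+2x ⟨
      x * x + (2 * y) * z         ≡⟨ cong (x * x +_) (*-assoc 2 y z) ⟩
      Q (x , y , z)               ≡⟨ Q≡8k+3 ⟩
      8 * k + 3                   ∎)
      where
      open ≡-Reasoning
      square : ∀ x z → (x + z) * (x + z) ≡ x * x + (z + 2 * x) * z
      square = solve-∀

    2x+2z≢y : 2 * x + 2 * z ≢ y
    2x+2z≢y refl = square≢8*k+3 (x + 2 * z) k (trans (sym (square x z)) Q≡8k+3)
      where
      square : ∀ x z → x * x + 2 * ((2 * x + 2 * z) * z) ≡ (x + 2 * z) * (x + 2 * z)
      square = solve-∀

    2y≢3x+2z : 2 * y ≢ 3 * x + 2 * z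
    2y≢3x+2z 2y≡3x+2z with x-odd
    ... | t , refl = odd≢even (3 * t + z + 1) y (trans (sym (odd t z)) (trans (sym 2y≡3x+2z) (double y)))
      where
      odd : ∀ t z → 3 * suc (t + t) + 2 * z ≡ suc ((3 * t + z + 1) + (3 * t + z + 1))
      odd = solve-∀
      double : ∀ y → 2 * y ≡ y + y
      double = solve-∀

    -- Here Q = (x + z)² + z² is a sum of two squares, hence not 3 mod 4.
    y≢x+z : y ≢ x + z
    y≢x+z refl with x-odd | even⊎odd z
    ... | t , refl | inj₁ (w , refl) = 4*a+1≢8*c+3 (t * t + t + w * (2 * t + 1 + 2 * w)) k (trans (sym (1-mod-4 t w)) Q≡8k+3)
      where
      1-mod-4 : ∀ t w → suc (t + t) * suc (t + t) + 2 * ((suc (t + t) + (w + w)) * (w + w))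
                        ≡ 4 * (t * t + t + w * (2 * t + 1 + 2 * w)) + 1
      1-mod-4 = solve-∀
    ... | t , refl | inj₂ (w , refl) = 4*a+1≢8*c+3 (t * t + t + (t + w + 1) * (2 * w + 1)) k (trans (sym (1-mod-4 t w)) Q≡8k+3)
      where
      1-mod-4 : ∀ t w → suc (t + t) * suc (t + t) + 2 * ((suc (t + t) + suc (w + w)) * suc (w + w))
                        ≡ 4 * (t * t + t + (t + w + 1) * (2 * w + 1)) + 1
      1-mod-4 = solve-∀

    -- Here Q = (x + 2z)² − 2z² with x odd, hence 1 or 7 mod 8.
    y≢2x+z : y ≢ 2 * x + z
    y≢2x+z refl with x-odd
    ... | t , refl with even⊎odd t | even⊎odd z
    ... | inj₁ (v , refl) | inj₁ (w , refl) = 8*a+1≢8*c+3 (2 * (v * v) + v + 4 * (v * w) + w + w * w) k (trans (sym (1-mod-8 v w)) Q≡8k+3)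
      where
      1-mod-8 : ∀ v w → suc ((v + v) + (v + v)) * suc ((v + v) + (v + v))
                        + 2 * ((2 * suc ((v + v) + (v + v)) + (w + w)) * (w + w))
                        ≡ 8 * (2 * (v * v) + v + 4 * (v * w) + w + w * w) + 1
      1-mod-8 = solve-∀
    ... | inj₂ (v , refl) | inj₁ (w , refl) = 8*a+1≢8*c+3 (2 * (v * v) + 3 * v + 1 + 4 * (v * w) + 3 * w + w * w) k (trans (sym (1-mod-8 v w)) Q≡8k+3)
      where
      1-mod-8 : ∀ v w → suc (suc (v + v) + suc (v + v)) * suc (suc (v + v) + suc (v + v))
                        + 2 * ((2 * suc (suc (v + v) + suc (v + v)) + (w + w)) * (w + w))
                        ≡ 8 * (2 * (v * v) + 3 * v + 1 + 4 * (v * w) + 3 * w + w * w) + 1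
      1-mod-8 = solve-∀
    ... | inj₁ (v , refl) | inj₂ (w , refl) = 8*a+7≢8*c+3 (2 * (v * v) + 3 * v + 4 * (v * w) + w * w + 2 * w) k (trans (sym (7-mod-8 v w)) Q≡8k+3)
      where
      7-mod-8 : ∀ v w → suc ((v + v) + (v + v)) * suc ((v + v) + (v + v))
                        + 2 * ((2 * suc ((v + v) + (v + v)) + suc (w + w)) * suc (w + w))
                        ≡ 8 * (2 * (v * v) + 3 * v + 4 * (v * w) + w * w + 2 * w) + 7
      7-mod-8 = solve-∀
    ... | inj₂ (v , refl) | inj₂ (w , refl) = 8*a+7≢8*c+3 (2 * (v * v) + 5 * v + 4 * (v * w) + w * w + 4 * w + 2) k (trans (sym (7-mod-8 v w)) Q≡8k+3)
      where
      7-mod-8 : ∀ v w → suc (suc (v + v) + suc (v + v)) * suc (suc (v + v) + suc (v + v))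
                        + 2 * ((2 * suc (suc (v + v) + suc (v + v)) + suc (w + w)) * suc (w + w))
                        ≡ 8 * (2 * (v * v) + 5 * v + 4 * (v * w) + w * w + 4 * w + 2) + 7
      7-mod-8 = solve-∀

  symmetric-y-odd : ∀ {x y k} → Q (x , y , y) ≡ 8 * k + 3 → ∃[ u ] y ≡ suc (u + u)
  symmetric-y-odd {x} {y} {k} Q≡8k+3 with Q≡8k+3⇒.x-odd {x} {y} {y} {k} Q≡8k+3 | even⊎odd y
  ... | _ | inj₂ odd = odd
  ... | t , refl | inj₁ (u , refl) = contradiction (trans (sym (1-mod-4 t u)) Q≡8k+3) (4*a+1≢8*c+3 (t * t + t + 2 * (u * u)) k)
    where
    1-mod-4 : ∀ t u → suc (t + t) * suc (t + t) + 2 * ((u + u) * (u + u)) ≡ 4 * (t * t + t + 2 * (u * u)) + 1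
    1-mod-4 = solve-∀

  module _ {x y c : ℕ} (Q≡3c : Q (x , y , y) ≡ 3 * c) where

    symmetric-3∣x⇒3∣y : 3 ∣ x → 3 ∣ y
    symmetric-3∣x⇒3∣y (divides a refl) =
      3∣n*n⇒3∣n y (3∣2*n⇒3∣n (y * y) (∣m+n∣m⇒∣n (subst (3 ∣_) (sym Q≡3c) (m∣m*n c)) (divides (3 * (a * a)) (a3² a))))
      where
      a3² : ∀ a → (a * 3) * (a * 3) ≡ (3 * (a * a)) * 3
      a3² = solve-∀

    symmetric-3∣y⇒3∣x : 3 ∣ y → 3 ∣ x
    symmetric-3∣y⇒3∣x (divides b refl) =
      3∣n*n⇒3∣n x (∣m+n∣m⇒∣n (subst (3 ∣_) (sym (trans (+-comm (2 * ((b * 3) * (b * 3))) (x * x)) Q≡3c)) (m∣m*n c))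
                             (divides (6 * (b * b)) (2b3² b)))
      where
      2b3² : ∀ b → 2 * ((b * 3) * (b * 3)) ≡ (6 * (b * b)) * 3
      2b3² = solve-∀

module NaturalWindmill where

  open import Data.Nat.Base as ℕ using (ℕ; suc)
  open import Data.Integer.Base using (+_; +[1+_]; ∣_∣; _+_; _*_)
  open import Data.Integer.Properties using (+-injective; pos-+; pos-*; abs-*)
  import Data.Nat.Properties as ℕP
  open import Data.Nat.Divisibility using (_∣_; divides)
  open import Data.Product.Base using (∃-syntax; _×_; _,_; proj₁; proj₂)
  open import Relation.Binary.PropositionalEquality using (_≡_; refl; sym; trans; cong; cong₂; subst; module ≡-Reasoning)
  open QuadraticForm
  module W = Windmill

  module _ {a b c k : ℕ} (Q≡8k+3 : Q (suc a , suc b , suc c) ≡ 8 ℕ.* k ℕ.+ 3) where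

    nonDegenerate : W.NonDegenerate (+[1+ a ] , +[1+ b ] , +[1+ c ])
    nonDegenerate = record
      { 2y≢x     = λ e → 2y≢x (+-injective (trans (pos-* 2 (suc b)) e))
      ; 2y≢z+2x  = λ e → 2y≢z+2x (+-injective (trans (pos-* 2 (suc b)) (trans e (sym (pos-+-* (suc c) 2 (suc a))))))
      ; 2x+2z≢y  = λ e → 2x+2z≢y (+-injective (trans (pos-*+* 2 (suc a) 2 (suc c)) e))
      ; 2y≢3x+2z = λ e → 2y≢3x+2z (+-injective (trans (pos-* 2 (suc b)) (trans e (sym (pos-*+* 3 (suc a) 2 (suc c))))))
      ; y≢x+z    = λ e → y≢x+z (+-injective (trans e (sym (pos-+ (suc a) (suc c)))))
      ; y≢2x+z   = λ e → y≢2x+z (+-injective (trans e (sym (pos-*+ 2 (suc a) (suc c)))))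
      }
      where
      open Q≡8k+3⇒ {suc a} {suc b} {suc c} {k} Q≡8k+3
      pos-+-* : ∀ m n o → + (m ℕ.+ n ℕ.* o) ≡ + m + + n * + o
      pos-+-* m n o = trans (pos-+ m (n ℕ.* o)) (cong (λ w → + m + w) (pos-* n o))
      pos-*+ : ∀ m n o → + (m ℕ.* n ℕ.+ o) ≡ + m * + n + + o
      pos-*+ m n o = trans (pos-+ (m ℕ.* n) o) (cong (_+ + o) (pos-* m n))
      pos-*+* : ∀ m n o p → + (m ℕ.* n ℕ.+ o ℕ.* p) ≡ + m * + n + + o * + p
      pos-*+* m n o p = trans (pos-+ (m ℕ.* n) (o ℕ.* p)) (cong₂ _+_ (pos-* m n) (pos-* o p))

  toℤ³ : ℕ³ → W.Triple
  toℤ³ (x , y , z) = (+ x , + y , + z)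

  abs³ : W.Triple → ℕ³
  abs³ (X , Y , Z) = (∣ X ∣ , ∣ Y ∣ , ∣ Z ∣)

  J : ℕ³ → ℕ³
  J s = abs³ (W.J (toℤ³ s))

  toℤ³∘abs³ : ∀ {u} → W.Positive³ u → toℤ³ (abs³ u) ≡ u
  toℤ³∘abs³ ((_ , refl) , (_ , refl) , (_ , refl)) = refl

  Q-toℤ³ : ∀ s → + Q s ≡ W.Q (toℤ³ s)
  Q-toℤ³ (x , y , z) = trans (pos-+ (x ℕ.* x) (2 ℕ.* (y ℕ.* z)))
                             (cong₂ _+_ (pos-* x x) (trans (pos-* 2 (y ℕ.* z)) (cong (+ 2 *_) (pos-* y z))))

  Positive : ℕ³ → Set
  Positive (x , y , z) = 1 ℕ.≤ x × 1 ℕ.≤ y × 1 ℕ.≤ z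

  record Behaviour (s : ℕ³) : Set where
    field
      positive    : Positive (J s)
      Q-preserved : Q (J s) ≡ Q s
      involutive  : J (J s) ≡ s
      fixed⇒x≡y   : J s ≡ s → proj₁ s ≡ proj₁ (proj₂ s)

  behaviour : ∀ {a b c k} → Q (suc a , suc b , suc c) ≡ 8 ℕ.* k ℕ.+ 3 → Behaviour (suc a , suc b , suc c)
  behaviour {a} {b} {c} {k} Q≡8k+3 = record
    { positive    = positive u-positive
    ; Q-preserved = +-injective (begin
        + Q (J s)             ≡⟨ Q-toℤ³ (J s) ⟩
        W.Q (toℤ³ (J s))      ≡⟨ cong W.Q toℤ³Js≡u ⟩
        W.Q u                 ≡⟨ W.Q-J (toℤ³ s) ⟩
        W.Q (toℤ³ s)          ≡⟨ Q-toℤ³ s ⟨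
        + Q s                 ∎)
    ; involutive  = cong abs³ (trans (cong W.J toℤ³Js≡u) (W.Step.involutive st))
    ; fixed⇒x≡y   = λ Js≡s → +-injective (W.Step.fixed⇒x≡y st (trans (sym toℤ³Js≡u) (cong toℤ³ Js≡s)))
    }
    where
    open ≡-Reasoning
    s = (suc a , suc b , suc c)
    st = W.step a b c (nonDegenerate {k = k} Q≡8k+3)
    u = W.J (toℤ³ s)
    u-positive : W.Positive³ u
    u-positive = W.Step.positive st
    toℤ³Js≡u : toℤ³ (J s) ≡ u
    toℤ³Js≡u = toℤ³∘abs³ u-positive
    positive : ∀ {u} → W.Positive³ u → Positive (abs³ u)
    positive ((_ , refl) , (_ , refl) , (_ , refl)) = ℕ.s≤s ℕ.z≤n , ℕ.s≤s ℕ.z≤n , ℕ.s≤s ℕ.z≤n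

  J-fixes-x=y : ∀ a c → J (suc a , suc a , suc c) ≡ (suc a , suc a , suc c)
  J-fixes-x=y a c = cong abs³ (W.J-fixes-x=y a c)

  Multiple³ : ℕ³ → Set
  Multiple³ (x , y , z) = (3 ∣ x) × (3 ∣ y) × (3 ∣ z)

  private
    pos-*3 : ∀ n → + (n ℕ.* 3) ≡ + 3 * + n
    pos-*3 n = trans (cong +_ (ℕP.*-comm n 3)) (pos-* 3 n)

    abs-multiple : ∀ {X} → ∃[ m ] X ≡ + 3 * m → 3 ∣ (∣ X ∣)
    abs-multiple (m , refl) = divides ∣ m ∣ (trans (abs-* (+ 3) m) (ℕP.*-comm 3 ∣ m ∣))

  J-preserves-multiples-of-3 : ∀ s → Multiple³ s → Multiple³ (J s)
  J-preserves-multiples-of-3 (.(u ℕ.* 3) , .(v ℕ.* 3) , .(w ℕ.* 3)) (divides u refl , divides v refl , divides w refl) =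
    let (m₁ , m₂ , m₃) = subst W.Multiple³ (cong W.J (sym scaled)) (W.J-preserves-multiples-of-3 (+ u) (+ v) (+ w))
    in abs-multiple m₁ , abs-multiple m₂ , abs-multiple m₃
    where
    scaled : toℤ³ (u ℕ.* 3 , v ℕ.* 3 , w ℕ.* 3) ≡ (+ 3 * + u , + 3 * + v , + 3 * + w)
    scaled = cong₂ _,_ (pos-*3 u) (cong₂ _,_ (pos-*3 v) (pos-*3 w))

module Representations where

  open import Data.Nat.Base
  open import Data.Nat.Properties using (_≟_; _≤?_; ≤-trans; ≤-reflexive; m≤m*n; m≤n*m; m≤m+n; m≤n+m; *-comm)
  open import Data.Nat.Divisibility using (_∣?_)
  open import Data.List.Base using (List; cartesianProduct)
  open import Data.List.Membership.Propositional using (_∈_)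
  open import Data.List.Membership.Propositional.Properties using (∈-cartesianProduct⁺)
  open import Data.List.Relation.Unary.Unique.Propositional using (Unique)
  open import Data.List.Relation.Unary.Unique.Propositional.Properties using (cartesianProduct⁺)
  open import Data.Product.Base using (_×_; _,_)
  open import Data.Product.Properties using (≡-dec)
  open import Relation.Binary.Definitions using (DecidableEquality)
  open import Relation.Binary.PropositionalEquality using (_≡_; refl; trans; cong; subst)
  open import Relation.Nullary.Decidable using (_×-dec_; ¬?)
  open import Relation.Nullary.Negation using (¬_)
  open import Relation.Unary using (Decidable)
  open import Relation.Unary.Properties using (_∩?_)
  open Counting
  open QuadraticForm
  open NaturalWindmill

  _≟³_ : DecidableEquality ℕ³
  _≟³_ = ≡-dec _≟_ (≡-dec _≟_ _≟_)

  cube : ℕ → List ℕ³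
  cube n = cartesianProduct (box n) (cartesianProduct (box n) (box n))

  cube-unique : ∀ n → Unique (cube n)
  cube-unique n = cartesianProduct⁺ (box-unique n) (cartesianProduct⁺ (box-unique n) (box-unique n))

  ∈-cube : ∀ {n x y z} → x ≤ n → y ≤ n → z ≤ n → (x , y , z) ∈ cube n
  ∈-cube x≤ y≤ z≤ = ∈-cartesianProduct⁺ (∈-box x≤) (∈-cartesianProduct⁺ (∈-box y≤) (∈-box z≤))

  Rep : ℕ → ℕ³ → Set
  Rep N s = Q s ≡ N × Positive s × ¬ Multiple³ s

  rep? : ∀ N → Decidable (Rep N)
  rep? N (x , y , z) =
    (Q (x , y , z) ≟ N) ×-dec ((1 ≤? x) ×-dec (1 ≤? y) ×-dec (1 ≤? z)) ×-dec ¬? ((3 ∣? x) ×-dec (3 ∣? y) ×-dec (3 ∣? z))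

  Rep⇒∈cube : ∀ {N} s → Rep N s → s ∈ cube N
  Rep⇒∈cube {N} (suc x , suc y , suc z) (Q≡N , _) =
    ∈-cube (≤-trans (m≤m*n (suc x) (suc x)) (≤-trans (m≤m+n _ _) (≤-reflexive Q≡N)))
           (≤-trans (m≤m*n (suc y) (suc z)) yz≤N)
           (≤-trans (m≤n*m (suc z) (suc y)) yz≤N)
    where
    yz≤N : suc y * suc z ≤ N
    yz≤N = ≤-trans (m≤m+n _ _) (≤-trans (m≤n+m _ (suc x * suc x)) (≤-reflexive Q≡N))

  swap : ℕ³ → ℕ³
  swap (x , y , z) = (x , z , y)

  Rep-swap : ∀ {N} s → Rep N s → Rep N (swap s)
  Rep-swap (x , y , z) (Q≡N , (1≤x , 1≤y , 1≤z) , ¬3∣) =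
    trans (cong (λ w → x * x + 2 * w) (*-comm z y)) Q≡N , (1≤x , 1≤z , 1≤y) , λ (a , b , c) → ¬3∣ (a , c , b)

  parity-swap : ∀ N → parity (count (rep? N) (cube N)) ≡ parity (count (rep? N ∩? λ s → swap s ≟³ s) (cube N))
  parity-swap N = parity-count-involution _≟³_ (rep? N) swap (cube-unique N)
    λ {s} _ rep → let rep′ = Rep-swap s rep in Rep⇒∈cube (swap s) rep′ , rep′ , refl

  module _ (k : ℕ) where

    private
      N = 8 * k + 3

    Rep⇒Behaviour : ∀ s → Rep N s → Behaviour s
    Rep⇒Behaviour (suc _ , suc _ , suc _) (Q≡N , _) = behaviour {k = k} Q≡N

    Rep-J : ∀ s → Rep N s → Rep N (J s)
    Rep-J s rep@(Q≡N , _ , ¬3∣) =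
      trans Q-preserved Q≡N , positive , λ 3∣Js → ¬3∣ (subst Multiple³ involutive (J-preserves-multiples-of-3 (J s) 3∣Js))
      where open Behaviour (Rep⇒Behaviour s rep)

    parity-J : parity (count (rep? N) (cube N)) ≡ parity (count (rep? N ∩? λ s → J s ≟³ s) (cube N))
    parity-J = parity-count-involution _≟³_ (rep? N) J (cube-unique N)
      λ {s} _ rep → let rep′ = Rep-J s rep in Rep⇒∈cube (J s) rep′ , rep′ , Behaviour.involutive (Rep⇒Behaviour s rep)

module PentagonalPairs where

  open import Data.Nat.Base
  open import Data.Nat.Properties using (_≟_; ≤-trans; ≤-reflexive; m≤m+n; m≤n+m; +-cancelʳ-≡; *-cancelˡ-≡)
  open import Data.Nat.Tactic.RingSolver using (solve-∀)
  open import Data.List.Base using (cartesianProduct)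
  open import Data.List.Membership.Propositional using (_∈_)
  open import Data.List.Membership.Propositional.Properties using (∈-cartesianProduct⁺)
  open import Data.List.Relation.Unary.Unique.Propositional.Properties using (cartesianProduct⁺)
  open import Data.Product.Base using (_×_; _,_; proj₁; proj₂)
  open import Data.Product.Properties using (≡-dec)
  open import Relation.Binary.PropositionalEquality using (_≡_; refl; sym; trans; cong; cong₂; module ≡-Reasoning)
  open import Relation.Unary.Properties using (_∩?_)
  open Counting
  open Pentagonal
  open QuadraticForm
  open Representations

  module _ (n : ℕ) where

    private
      N = 8 * (3 * n) + 3

      toTriple : ℕ × ℕ → ℕ³
      toTriple (i , j) = (pentagonalRoot i , pentagonalRoot j , pentagonalRoot j)

      toPair : ℕ³ → ℕ × ℕ
      toPair (x , y , _) = (x / 3 , y / 3)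

      Q-toTriple : ∀ i j → Q (toTriple (i , j)) ≡ 24 * (G i + 2 * G j) + 3
      Q-toTriple i j = begin
        Q (toTriple (i , j))                                     ≡⟨ cong₂ (λ u v → u + 2 * v)
                                                                          (24*G+1≡pentagonalRoot² i) (24*G+1≡pentagonalRoot² j) ⟨
        (24 * G i + 1) + 2 * (24 * G j + 1)                      ≡⟨ regroup (G i) (G j) ⟩
        24 * (G i + 2 * G j) + 3                                 ∎
        where
        open ≡-Reasoning
        regroup : ∀ g h → (24 * g + 1) + 2 * (24 * h + 1) ≡ 24 * (g + 2 * h) + 3
        regroup = solve-∀

      24n+3≡N : 24 * n + 3 ≡ N
      24n+3≡N = regroup n
        where
        regroup : ∀ n → 24 * n + 3 ≡ 8 * (3 * n) + 3
        regroup = solve-∀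

    r≡count-symmetric-Rep : r n ≡ count (rep? N ∩? λ s → swap s ≟³ s) (cube N)
    r≡count-symmetric-Rep = count-bijection (≡-dec _≟_ _≟_) _≟³_ (λ p → G (proj₁ p) + 2 * G (proj₂ p) ≟ n)
      (rep? N ∩? λ s → swap s ≟³ s) toTriple toPair
      (cartesianProduct⁺ (box-unique n) (box-unique n)) (cube-unique N) toTriple-maps toPair-maps
      where
      toTriple-maps : ∀ {p} → p ∈ cartesianProduct (box n) (box n) → G (proj₁ p) + 2 * G (proj₂ p) ≡ n →
                      toTriple p ∈ cube N × (Rep N (toTriple p) × swap (toTriple p) ≡ toTriple p) × toPair (toTriple p) ≡ p
      toTriple-maps {i , j} _ G≡n = Rep⇒∈cube _ rep , (rep , refl) , cong₂ _,_ (pentagonalRoot/3≡i i) (pentagonalRoot/3≡i j)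
        where
        rep : Rep N (toTriple (i , j))
        rep = trans (Q-toTriple i j) (trans (cong (λ w → 24 * w + 3) G≡n) 24n+3≡N) ,
              (pentagonalRoot-positive i , pentagonalRoot-positive j , pentagonalRoot-positive j) ,
              λ (3∣x , _) → 3∤pentagonalRoot i 3∣x
      toPair-maps : ∀ {s} → s ∈ cube N → Rep N s × swap s ≡ s →
                    toPair s ∈ cartesianProduct (box n) (box n) × G (proj₁ (toPair s)) + 2 * G (proj₂ (toPair s)) ≡ n × toTriple (toPair s) ≡ s
      toPair-maps {x , y , .y} _ ((Q≡N , _ , ¬3∣) , refl) =
        ∈-cartesianProduct⁺ (∈-box (≤-trans (n≤G (x / 3)) (≤-trans (m≤m+n _ _) (≤-reflexive G≡n))))
                            (∈-box (≤-trans (n≤G (y / 3)) (≤-trans (m≤m+n (G (y / 3)) (G (y / 3) + 0))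
                                                     (≤-trans (m≤n+m (2 * G (y / 3)) (G (x / 3))) (≤-reflexive G≡n))))) ,
        G≡n ,
        cong₂ _,_ x≡root (cong₂ _,_ y≡root y≡root)
        where
        N≡3*[8n+1] : ∀ n → 8 * (3 * n) + 3 ≡ 3 * (8 * n + 1)
        N≡3*[8n+1] = solve-∀
        Q≡3c = trans Q≡N (N≡3*[8n+1] n)
        3∣x⇒3∣y = symmetric-3∣x⇒3∣y {x} {y} {8 * n + 1} Q≡3c
        3∤x = λ 3∣x → ¬3∣ (3∣x , 3∣x⇒3∣y 3∣x , 3∣x⇒3∣y 3∣x)
        3∤y = λ 3∣y → ¬3∣ (symmetric-3∣y⇒3∣x {x} {y} {8 * n + 1} Q≡3c 3∣y , 3∣y , 3∣y)
        x≡root = pentagonalRoot-surjective x 3∤x (Q≡8k+3⇒.x-odd {x} {y} {y} {3 * n} Q≡N)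
        y≡root = pentagonalRoot-surjective y 3∤y (symmetric-y-odd {x} {y} {3 * n} Q≡N)
        G≡n : G (x / 3) + 2 * G (y / 3) ≡ n
        G≡n = *-cancelˡ-≡ _ _ 24 (+-cancelʳ-≡ 3 _ _ (trans (sym (Q-toTriple (x / 3) (y / 3)))
                (trans (cong₂ (λ u v → Q (u , v , v)) x≡root y≡root) (trans Q≡N (sym 24n+3≡N)))))

module DivisorParity where

  open import Data.Nat.Base
  open import Data.Nat.Properties using (*-cancelˡ-≡; *-comm; *-mono-<; *-zeroʳ; <-cmp; <⇒≢; _≟_; m<m*n; m≤m*n; ≤-trans)
  open import Data.Nat.DivMod using (m*n/n≡m; m/n*n≡m)
  open import Data.Nat.Divisibility using (_∣_; _∣?_; divides; ∣⇒≤; ∣-trans; m∣m*n; 0∣⇒≡0)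
  open import Data.Nat.Coprimality using (Coprime; coprime-divisor)
  open import Data.Nat.Primality using (prime⇒irreducible)
  open import Data.Nat.Induction using (<-wellFounded)
  open import Data.Nat.Tactic.RingSolver using (solve-∀)
  open import Data.Parity.Base using (0ℙ; 1ℙ)
  open import Data.List.Membership.Propositional using (_∈_)
  open import Data.Product.Base using (∃-syntax; _×_; _,_; proj₁)
  open import Data.Sum.Base using (_⊎_; inj₁; inj₂) renaming (swap to swap-⊎)
  open import Function.Bundles using (_⇔_; mk⇔)
  open import Function.Properties.Equivalence using () renaming (sym to ⇔-sym)
  open import Function.Related.Propositional using (module EquationalReasoning; equivalence)
  open import Data.Sum.Function.Propositional using (_⊎-⇔_)
  open import Induction.WellFounded using (Acc; acc)
  open import Relation.Binary.Definitions using (tri<; tri≈; tri>)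
  open import Relation.Binary.PropositionalEquality using (_≡_; _≢_; refl; sym; trans; cong; subst; module ≡-Reasoning)
  open import Relation.Nullary.Decidable using (yes; no; _×-dec_; ¬?)
  open import Relation.Nullary.Negation using (¬_; contradiction)
  open import Relation.Unary using (Decidable)
  open import Relation.Unary.Properties using (_∩?_)
  open Counting
  open Arithmetic

  IsSquare : ℕ → Set
  IsSquare n = ∃[ s ] s * s ≡ n

  square-injective : ∀ a b → a * a ≡ b * b → a ≡ b
  square-injective a b a²≡b² with <-cmp a b
  ... | tri< a<b _ _ = contradiction a²≡b² (<⇒≢ (*-mono-< a<b a<b))
  ... | tri≈ _ a≡b _ = a≡b
  ... | tri> _ _ b<a = contradiction (sym a²≡b²) (<⇒≢ (*-mono-< b<a b<a))

  square-root≤ : ∀ {s n} → s * s ≡ n → s ≤ n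
  square-root≤ {zero}  _    = z≤n
  square-root≤ {suc t} refl = m≤m*n (suc t) (suc t)

  module _ (K : ℕ) where

    square-root? : Decidable (λ q → q * q ≡ K)
    square-root? q = q * q ≟ K

    count-square-roots-square : IsSquare K → count square-root? (box K) ≡ 1
    count-square-roots-square (s , s²≡K) = begin
      count square-root? (box K)              ≡⟨ count-remove _≟_ square-root? (box-unique K) (∈-box (square-root≤ s²≡K)) s²≡K ⟩
      suc (count other-square-root? (box K))  ≡⟨ cong suc (count≡0 other-square-root? {box K} λ _ (q²≡K , q≢s) →
                                                   q≢s (square-injective _ s (trans q²≡K (sym s²≡K)))) ⟩
      1                                       ∎
      where
      open ≡-Reasoning
      other-square-root? = square-root? ∩? (λ q → ¬? (q ≟ s))

    module _ (1≤K : 1 ≤ K) where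

      cofactor : ℕ → ℕ
      cofactor zero        = zero
      cofactor q@(suc _)   = K / q

      cofactor-spec : ∀ {p q} → K ≡ p * q → cofactor q ≡ p
      cofactor-spec {p} {zero}  K≡p*0 = contradiction (trans K≡p*0 (*-zeroʳ p)) (≢-nonZero⁻¹ K)
        where instance _ = >-nonZero 1≤K
      cofactor-spec {p} {suc q} K≡pq = trans (cong (_/ suc q) K≡pq) (m*n/n≡m p (suc q))

      divisor≢0 : ∀ {q} → q ∣ K → q ≢ 0
      divisor≢0 q∣K refl = contradiction (0∣⇒≡0 q∣K) (≢-nonZero⁻¹ K)
        where instance _ = >-nonZero 1≤K

      parity-divisors≡parity-square-roots : parity (count (_∣? K) (box K)) ≡ parity (count square-root? (box K))
      parity-divisors≡parity-square-roots =
        trans (parity-count-involution _≟_ (_∣? K) cofactor (box-unique K) cofactor-involutive)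
              (cong parity (count-cong ((_∣? K) ∩? λ q → cofactor q ≟ q) square-root? fixed⇒square square⇒fixed))
        where
        cofactor-involutive : ∀ {q} → q ∈ box K → q ∣ K → cofactor q ∈ box K × cofactor q ∣ K × cofactor (cofactor q) ≡ q
        cofactor-involutive {q} _ q∣K@(divides p K≡pq) =
          subst (λ c → c ∈ box K × c ∣ K × cofactor c ≡ q) (sym (cofactor-spec K≡pq))
            (∈-box (∣⇒≤ {{>-nonZero 1≤K}} p∣K) , p∣K , cofactor-spec (trans K≡pq (*-comm p q)))
          where
          p∣K : p ∣ K
          p∣K = divides q (trans K≡pq (*-comm p q))
        fixed⇒square : ∀ {q} → q ∈ box K → q ∣ K × cofactor q ≡ q → q * q ≡ K
        fixed⇒square {zero}  _ (q∣K , _) = contradiction refl (divisor≢0 q∣K)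
        fixed⇒square {suc q} _ (q∣K , K/q≡q) = trans (cong (_* suc q) (sym K/q≡q)) (m/n*n≡m q∣K)
        square⇒fixed : ∀ {q} → q ∈ box K → q * q ≡ K → q ∣ K × cofactor q ≡ q
        square⇒fixed {q} _ q²≡K = divides q (sym q²≡K) , cofactor-spec (sym q²≡K)

      parity-divisors≡1ℙ⇔square : parity (count (_∣? K) (box K)) ≡ 1ℙ ⇔ IsSquare K
      parity-divisors≡1ℙ⇔square = mk⇔
        (λ odd → count≢0⇒∃ square-root? {box K} λ c≡0 →
           0ℙ≢1ℙ (trans (cong parity (sym c≡0)) (trans (sym parity-divisors≡parity-square-roots) odd)))
        (λ □ → trans parity-divisors≡parity-square-roots (cong parity (count-square-roots-square □)))
        where
        0ℙ≢1ℙ : 0ℙ ≢ 1ℙ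
        0ℙ≢1ℙ ()

  DivisorPrimeTo3 : ℕ → ℕ → Set
  DivisorPrimeTo3 M q = q ∣ M × ¬ 3 ∣ q

  divisorPrimeTo3? : ∀ M → Decidable (DivisorPrimeTo3 M)
  divisorPrimeTo3? M q = (q ∣? M) ×-dec ¬? (3 ∣? q)

  3∤⇒coprime : ∀ {q} → ¬ 3 ∣ q → Coprime q 3
  3∤⇒coprime 3∤q (d∣q , d∣3) with prime⇒irreducible 3-prime d∣3
  ... | inj₁ d≡1 = d≡1
  ... | inj₂ refl = contradiction d∣q 3∤q

  count-divisorsPrimeTo3-3∤ : ∀ K → ¬ 3 ∣ K → count (divisorPrimeTo3? K) (box K) ≡ count (_∣? K) (box K)
  count-divisorsPrimeTo3-3∤ K 3∤K = count-cong (divisorPrimeTo3? K) (_∣? K) {box K} (λ _ → proj₁)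
    λ _ q∣K → q∣K , λ 3∣q → 3∤K (∣-trans 3∣q q∣K)

  count-divisorsPrimeTo3-*3 : ∀ K → 1 ≤ K → count (divisorPrimeTo3? (K * 3)) (box (K * 3)) ≡ count (divisorPrimeTo3? K) (box K)
  count-divisorsPrimeTo3-*3 K 1≤K = count-bijection _≟_ _≟_ (divisorPrimeTo3? (K * 3)) (divisorPrimeTo3? K) (λ q → q) (λ q → q)
    (box-unique (K * 3)) (box-unique K)
    (λ {q} _ (q∣3K , 3∤q) → let q∣K = coprime-divisor (3∤⇒coprime 3∤q) (subst (q ∣_) (*-comm K 3) q∣3K) in
                        ∈-box (∣⇒≤ {{>-nonZero 1≤K}} q∣K) , (q∣K , 3∤q) , refl)
    (λ _ (q∣K , 3∤q) → let q∣3K = ∣-trans q∣K (m∣m*n 3) in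
                        ∈-box (∣⇒≤ {{>-nonZero (≤-trans 1≤K (m≤m*n K 3))}} q∣3K) , (q∣3K , 3∤q) , refl)

  private
    [a*3]² : ∀ a → (a * 3) * (a * 3) ≡ 3 * (3 * (a * a))
    [a*3]² = solve-∀

  3∤⇒¬square-3* : ∀ K → ¬ 3 ∣ K → ¬ IsSquare (3 * K)
  3∤⇒¬square-3* K 3∤K (s , s²≡3K) with divides a refl ← 3∣n*n⇒3∣n s (divides K (trans s²≡3K (*-comm 3 K))) =
    3∤K (divides (a * a) (trans (*-cancelˡ-≡ K (3 * (a * a)) 3 (trans (sym s²≡3K) ([a*3]² a))) (*-comm 3 (a * a))))

  square-9* : ∀ K → IsSquare (3 * (K * 3)) ⇔ IsSquare K
  square-9* K = mk⇔
    (λ (s , s²≡9K) → case-3∣ s s²≡9K (3∣n*n⇒3∣n s (divides (K * 3) (trans s²≡9K (*-comm 3 (K * 3))))))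
    (λ (s , s²≡K) → s * 3 , trans ([a*3]² s) (trans (cong (λ w → 3 * (3 * w)) s²≡K) (cong (3 *_) (*-comm 3 K))))
    where
    case-3∣ : ∀ s → s * s ≡ 3 * (K * 3) → 3 ∣ s → IsSquare K
    case-3∣ .(a * 3) s²≡9K (divides a refl) =
      a , *-cancelˡ-≡ (a * a) K 3 (*-cancelˡ-≡ (3 * (a * a)) (3 * K) 3
            (trans (sym ([a*3]² a)) (trans s²≡9K (cong (3 *_) (*-comm K 3)))))

  square-*3⇔square-3* : ∀ K → IsSquare (K * 3) ⇔ IsSquare (3 * K)
  square-*3⇔square-3* K = mk⇔ (λ (s , e) → s , trans e (*-comm K 3)) (λ (s , e) → s , trans e (*-comm 3 K))

  PrimeTo3DivisorParity : ℕ → Set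
  PrimeTo3DivisorParity K = parity (count (divisorPrimeTo3? K) (box K)) ≡ 1ℙ ⇔ (IsSquare K ⊎ IsSquare (3 * K))

  primeTo3DivisorParity-3∤ : ∀ K → 1 ≤ K → ¬ 3 ∣ K → PrimeTo3DivisorParity K
  primeTo3DivisorParity-3∤ K 1≤K 3∤K = begin
    parity (count (divisorPrimeTo3? K) (box K)) ≡ 1ℙ  ∼⟨ ≡⇒⇔≡ (cong parity (count-divisorsPrimeTo3-3∤ K 3∤K)) ⟩
    parity (count (_∣? K) (box K)) ≡ 1ℙ               ∼⟨ parity-divisors≡1ℙ⇔square K 1≤K ⟩
    IsSquare K                                        ∼⟨ ⇔-sym (⊎-¬ʳ (3∤⇒¬square-3* K 3∤K)) ⟩
    (IsSquare K ⊎ IsSquare (3 * K))                   ∎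
    where open EquationalReasoning {k = equivalence}

  primeTo3DivisorParity-*3 : ∀ K → 1 ≤ K → PrimeTo3DivisorParity K → PrimeTo3DivisorParity (K * 3)
  primeTo3DivisorParity-*3 K 1≤K claim = begin
    parity (count (divisorPrimeTo3? (K * 3)) (box (K * 3))) ≡ 1ℙ  ∼⟨ ≡⇒⇔≡ (cong parity (count-divisorsPrimeTo3-*3 K 1≤K)) ⟩
    parity (count (divisorPrimeTo3? K) (box K)) ≡ 1ℙ              ∼⟨ claim ⟩
    (IsSquare K ⊎ IsSquare (3 * K))                               ∼⟨ mk⇔ swap-⊎ swap-⊎ ⟩
    (IsSquare (3 * K) ⊎ IsSquare K)                               ∼⟨ ⇔-sym (square-*3⇔square-3* K) ⊎-⇔ ⇔-sym (square-9* K) ⟩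
    (IsSquare (K * 3) ⊎ IsSquare (3 * (K * 3)))                   ∎
    where open EquationalReasoning {k = equivalence}

  primeTo3DivisorParity : ∀ K → 1 ≤ K → PrimeTo3DivisorParity K
  primeTo3DivisorParity K = go K (<-wellFounded K)
    where
    go : ∀ K → Acc _<_ K → 1 ≤ K → PrimeTo3DivisorParity K
    go K _ 1≤K with 3 ∣? K
    go K _ 1≤K | no 3∤K = primeTo3DivisorParity-3∤ K 1≤K 3∤K
    go .(suc k * 3) (acc rs) _ | yes (divides (suc k) refl) =
      primeTo3DivisorParity-*3 (suc k) (s≤s z≤n) (go (suc k) (rs (m<m*n (suc k) 3 (s≤s (s≤s z≤n)))) (s≤s z≤n))

module FixedPoints where

  open import Data.Nat.Base
  open import Data.Nat.Properties using (*-assoc; *-cancelˡ-≡; *-comm; <-cmp; _≟_; _<?_; m+n∸m≡n; m+n≮m; m<m+n; m≤m+n; ≤-trans)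
  open import Data.Nat.DivMod using (m*n/n≡m)
  open import Data.Nat.Divisibility using (_∣_; _∣?_; ∣⇒≤; divides; ∣-trans; ∣m+n∣m⇒∣n; ∣m∣n⇒∣m+n; m∣m*n; n∣m*n)
  open import Data.Nat.Primality using (euclidsLemma)
  open import Data.Nat.Tactic.RingSolver using (solve-∀)
  open import Data.Product.Base using (∃-syntax; _×_; _,_)
  open import Data.Sum.Base using (inj₁; inj₂)
  open import Relation.Binary.Definitions using (tri<; tri≈; tri>)
  open import Relation.Binary.PropositionalEquality using (_≡_; refl; sym; trans; cong; subst; module ≡-Reasoning)
  open import Relation.Nullary.Decidable using (yes; no)
  open import Relation.Unary using (Decidable)
  open import Relation.Unary.Properties using (_∩?_)
  open import Data.List.Membership.Propositional using (_∈_)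
  open import Relation.Nullary.Negation using (¬_; contradiction)
  open Counting
  open Arithmetic
  open QuadraticForm
  open NaturalWindmill
  open Representations
  open DivisorParity using (DivisorPrimeTo3; divisorPrimeTo3?)

  -- A fixed point (x, x, z) factors 3M as x (x + 2z); exactly one factor is prime to 3, and it divides M.
  fixed→divisor : ℕ³ → ℕ
  fixed→divisor (x , _ , z) with 3 ∣? x
  ... | yes _ = x + 2 * z
  ... | no _  = x

  factors→fixed : ℕ → ℕ → ℕ³
  factors→fixed p q with 3 * p <? q
  ... | yes _ = (3 * p , 3 * p , (q ∸ 3 * p) / 2)
  ... | no _  = (q , q , (3 * p ∸ q) / 2)

  -- The value at q = 0 is junk: 0 never divides an odd M.
  divisor→fixed : ℕ → ℕ → ℕ³
  divisor→fixed M zero      = (0 , 0 , 0)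
  divisor→fixed M q@(suc _) = factors→fixed (M / q) q

  fixed→divisor-3∣ : ∀ x y z → 3 ∣ x → fixed→divisor (x , y , z) ≡ x + 2 * z
  fixed→divisor-3∣ x y z 3∣x with 3 ∣? x
  ... | yes _   = refl
  ... | no 3∤x = contradiction 3∣x 3∤x

  fixed→divisor-3∤ : ∀ x y z → ¬ 3 ∣ x → fixed→divisor (x , y , z) ≡ x
  fixed→divisor-3∤ x y z 3∤x with 3 ∣? x
  ... | yes 3∣x = contradiction 3∣x 3∤x
  ... | no _    = refl

  factors→fixed-< : ∀ p e → factors→fixed p (3 * p + 2 * suc e) ≡ (3 * p , 3 * p , suc e)
  factors→fixed-< p e with 3 * p <? 3 * p + 2 * suc e
  ... | yes _ = cong (λ w → (3 * p , 3 * p , w)) (trans (cong (_/ 2) (m+n∸m≡n (3 * p) (2 * suc e))) (half-double (suc e)))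
  ... | no ≮ = contradiction (m<m+n (3 * p) (s≤s z≤n)) ≮

  factors→fixed-≥ : ∀ p q e → 3 * p ≡ q + 2 * e → factors→fixed p q ≡ (q , q , e)
  factors→fixed-≥ p q e 3p≡ with 3 * p <? q
  ... | yes 3p<q = contradiction (subst (_< q) 3p≡ 3p<q) (m+n≮m q (2 * e))
  ... | no _     = cong (λ w → (q , q , w)) (trans (cong (λ w → (w ∸ q) / 2) 3p≡)
                                                   (trans (cong (_/ 2) (m+n∸m≡n q (2 * e))) (half-double e)))

  divisor→fixed-cofactor : ∀ {M p q} → p * q ≡ M → 1 ≤ q → divisor→fixed M q ≡ factors→fixed p q
  divisor→fixed-cofactor {p = p} {q = suc q} refl _ = cong (λ w → factors→fixed w (suc q)) (m*n/n≡m p (suc q))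

  Q-diagonal : ∀ x z → Q (x , x , z) ≡ x * (x + 2 * z)
  Q-diagonal x z = factor x z
    where
    factor : ∀ x z → x * x + 2 * (x * z) ≡ x * (x + 2 * z)
    factor = solve-∀

  fixed→divisor-spec : ∀ M x z → Rep (3 * M) (x , x , z) →
                       let q = fixed→divisor (x , x , z) in q ∣ M × ¬ 3 ∣ q × divisor→fixed M q ≡ (x , x , z)
  fixed→divisor-spec M x (suc e) (Q≡3M , (1≤x , _) , ¬3∣) with 3 ∣? x
  ... | yes (divides a refl) =
    divides a (sym av≡M) ,
    (λ 3∣v → ¬3∣ (n∣m*n a , n∣m*n a , 3∣2*n⇒3∣n (suc e) (∣m+n∣m⇒∣n 3∣v (n∣m*n a)))) ,
    (begin
      divisor→fixed M v                            ≡⟨ divisor→fixed-cofactor av≡M (≤-trans 1≤x (m≤m+n _ _)) ⟩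
      factors→fixed a v                            ≡⟨ cong (λ w → factors→fixed a (w + 2 * suc e)) (*-comm a 3) ⟩
      factors→fixed a (3 * a + 2 * suc e)          ≡⟨ factors→fixed-< a e ⟩
      (3 * a , 3 * a , suc e)                      ≡⟨ cong (λ w → (w , w , suc e)) (*-comm 3 a) ⟩
      (a * 3 , a * 3 , suc e)                      ∎)
    where
    open ≡-Reasoning
    v = a * 3 + 2 * suc e
    av≡M : a * v ≡ M
    av≡M = *-cancelˡ-≡ (a * v) M 3 (begin
      3 * (a * v)              ≡⟨ regroup a v ⟨
      (a * 3) * v              ≡⟨ Q-diagonal (a * 3) (suc e) ⟨
      Q (a * 3 , a * 3 , suc e) ≡⟨ Q≡3M ⟩
      3 * M                    ∎)
      where
      regroup : ∀ a v → (a * 3) * v ≡ 3 * (a * v)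
      regroup = solve-∀
  ... | no 3∤x with euclidsLemma x (x + 2 * suc e) 3-prime (divides M (trans (sym (Q-diagonal x (suc e))) (trans Q≡3M (*-comm 3 M))))
  ...   | inj₁ 3∣x = contradiction 3∣x 3∤x
  ...   | inj₂ (divides b 3b≡) =
    divides b (sym bx≡M) , 3∤x , trans (divisor→fixed-cofactor bx≡M 1≤x) (factors→fixed-≥ b x (suc e) (trans (*-comm 3 b) (sym 3b≡)))
    where
    bx≡M : b * x ≡ M
    bx≡M = *-cancelˡ-≡ (b * x) M 3 (begin
      3 * (b * x)             ≡⟨ regroup x b ⟨
      x * (b * 3)             ≡⟨ cong (x *_) 3b≡ ⟨
      x * (x + 2 * suc e)     ≡⟨ Q-diagonal x (suc e) ⟨
      Q (x , x , suc e)       ≡⟨ Q≡3M ⟩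
      3 * M                   ∎)
      where
      open ≡-Reasoning
      regroup : ∀ x b → x * (b * 3) ≡ 3 * (b * x)
      regroup = solve-∀

  diagonal-fixed-Rep : ∀ {M} a e → Q (suc a , suc a , suc e) ≡ 3 * M → ¬ Multiple³ (suc a , suc a , suc e) →
                       Rep (3 * M) (suc a , suc a , suc e) × J (suc a , suc a , suc e) ≡ (suc a , suc a , suc e)
  diagonal-fixed-Rep a e Q≡3M ¬3∣ = (Q≡3M , (s≤s z≤n , s≤s z≤n , s≤s z≤n) , ¬3∣) , J-fixes-x=y a e

  3*odd : ∀ v → ∃[ w ] 3 * suc (v + v) ≡ suc (w + w)
  3*odd v = 3 * v + 1 , regroup v
    where
    regroup : ∀ v → 3 * suc (v + v) ≡ suc ((3 * v + 1) + (3 * v + 1))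
    regroup = solve-∀

  DivisorFixedSpec : ℕ → ℕ → Set
  DivisorFixedSpec M q = let s = divisor→fixed M q in (Rep (3 * M) s × J s ≡ s) × fixed→divisor s ≡ q

  divisor>3*cofactor⇒spec : ∀ {M} p′ q e → M ≡ suc p′ * q → ¬ 3 ∣ q → q ≡ 3 * suc p′ + 2 * suc e → DivisorFixedSpec M q
  divisor>3*cofactor⇒spec {M} p′ q e M≡pq 3∤q q≡ =
    subst (λ s → (Rep (3 * M) s × J s ≡ s) × fixed→divisor s ≡ q) (sym s≡)
      (diagonal-fixed-Rep {M} _ e Q≡3M (λ (_ , _ , 3∣E) → 3∤q (subst (3 ∣_) (sym q≡) (∣m∣n⇒∣m+n (m∣m*n p) (∣-trans 3∣E (n∣m*n 2))))) ,
       trans (fixed→divisor-3∣ (3 * p) (3 * p) (suc e) (m∣m*n p)) (sym q≡))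
    where
    open ≡-Reasoning
    p = suc p′
    s≡ : divisor→fixed M q ≡ (3 * p , 3 * p , suc e)
    s≡ = trans (divisor→fixed-cofactor (sym M≡pq) (subst (1 ≤_) (sym q≡) (s≤s z≤n)))
               (trans (cong (factors→fixed p) q≡) (factors→fixed-< p e))
    Q≡3M : Q (3 * p , 3 * p , suc e) ≡ 3 * M
    Q≡3M = begin
      Q (3 * p , 3 * p , suc e)         ≡⟨ Q-diagonal (3 * p) (suc e) ⟩
      (3 * p) * (3 * p + 2 * suc e)     ≡⟨ cong ((3 * p) *_) q≡ ⟨
      (3 * p) * q                       ≡⟨ *-assoc 3 p q ⟩
      3 * (p * q)                       ≡⟨ cong (3 *_) M≡pq ⟨
      3 * M                             ∎

  divisor<3*cofactor⇒spec : ∀ {M} p q′ e → M ≡ p * suc q′ → ¬ 3 ∣ suc q′ → 3 * p ≡ suc q′ + 2 * suc e → DivisorFixedSpec M (suc q′)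
  divisor<3*cofactor⇒spec {M} p q′ e M≡pq 3∤q 3p≡ =
    subst (λ s → (Rep (3 * M) s × J s ≡ s) × fixed→divisor s ≡ q) (sym s≡)
      (diagonal-fixed-Rep {M} q′ e Q≡3M (λ (3∣q , _) → 3∤q 3∣q) , fixed→divisor-3∤ q q (suc e) 3∤q)
    where
    open ≡-Reasoning
    q = suc q′
    s≡ : divisor→fixed M q ≡ (q , q , suc e)
    s≡ = trans (divisor→fixed-cofactor (sym M≡pq) (s≤s z≤n)) (factors→fixed-≥ p q (suc e) 3p≡)
    Q≡3M : Q (q , q , suc e) ≡ 3 * M
    Q≡3M = begin
      Q (q , q , suc e)         ≡⟨ Q-diagonal q (suc e) ⟩
      q * (q + 2 * suc e)       ≡⟨ cong (q *_) 3p≡ ⟨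
      q * (3 * p)               ≡⟨ regroup p q ⟩
      3 * (p * q)               ≡⟨ cong (3 *_) M≡pq ⟨
      3 * M                     ∎
      where
      regroup : ∀ p q → q * (3 * p) ≡ 3 * (p * q)
      regroup = solve-∀

  private
    odd-divisor→fixed-spec : ∀ M u v → M ≡ suc (v + v) * suc (u + u) → ¬ 3 ∣ suc (u + u) → DivisorFixedSpec M (suc (u + u))
    odd-divisor→fixed-spec M u v M≡pq 3∤q with <-cmp (3 * suc (v + v)) (suc (u + u))
    ... | tri≈ _ 3p≡q _ = contradiction (divides (suc (v + v)) (trans (sym 3p≡q) (*-comm 3 (suc (v + v))))) 3∤q
    ... | tri< 3p<q _ _ with e , q≡ ← odd<odd⇒even-gap (3*odd v) (u , refl) 3p<q =
      divisor>3*cofactor⇒spec (v + v) (suc (u + u)) e M≡pq 3∤q q≡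
    ... | tri> _ _ q<3p with e , 3p≡ ← odd<odd⇒even-gap (u , refl) (3*odd v) q<3p =
      divisor<3*cofactor⇒spec (suc (v + v)) (u + u) e M≡pq 3∤q 3p≡

  divisor→fixed-spec : ∀ M → ∃[ m ] M ≡ suc (m + m) → ∀ q → q ∣ M → ¬ 3 ∣ q → DivisorFixedSpec M q
  divisor→fixed-spec M (m , M≡odd) q (divides p M≡pq) 3∤q
    with odd-product⇒odd-factors {p} {q} (m , trans (sym M≡pq) M≡odd)
  ... | (v , refl) , (u , refl) = odd-divisor→fixed-spec M u v M≡pq 3∤q

  module _ (n : ℕ) where

    private
      N = 8 * (3 * n) + 3
      M = 8 * n + 1
      N≡3M : N ≡ 3 * M
      N≡3M = regroup n
        where
        regroup : ∀ n → 8 * (3 * n) + 3 ≡ 3 * (8 * n + 1)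
        regroup = solve-∀
      M≡odd : M ≡ suc (4 * n + 4 * n)
      M≡odd = regroup n
        where
        regroup : ∀ n → 8 * n + 1 ≡ suc (4 * n + 4 * n)
        regroup = solve-∀

    count-fixed-Rep≡count-divisors : count (rep? N ∩? λ s → J s ≟³ s) (cube N) ≡ count (divisorPrimeTo3? M) (box M)
    count-fixed-Rep≡count-divisors =
      count-bijection _≟³_ _≟_ (rep? N ∩? λ s → J s ≟³ s) (divisorPrimeTo3? M) fixed→divisor (divisor→fixed M)
        (cube-unique N) (box-unique M) fixed-maps divisor-maps
      where
      fixed-maps : ∀ {s} → s ∈ cube N → Rep N s × J s ≡ s →
                   fixed→divisor s ∈ box M × DivisorPrimeTo3 M (fixed→divisor s) × divisor→fixed M (fixed→divisor s) ≡ s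
      fixed-maps {x , y , z} _ (rep , Js≡s) with refl ← Behaviour.fixed⇒x≡y (Rep⇒Behaviour (3 * n) (x , y , z) rep) Js≡s
        with q∣M , 3∤q , back ← fixed→divisor-spec M x z (subst (λ K → Rep K (x , x , z)) N≡3M rep) =
        ∈-box (subst (fixed→divisor (x , x , z) ≤_) (sym M≡odd) (∣⇒≤ (subst (fixed→divisor (x , x , z) ∣_) M≡odd q∣M))) ,
        (q∣M , 3∤q) , back
      divisor-maps : ∀ {q} → q ∈ box M → DivisorPrimeTo3 M q →
                     divisor→fixed M q ∈ cube N × (Rep N (divisor→fixed M q) × J (divisor→fixed M q) ≡ divisor→fixed M q) ×
                     fixed→divisor (divisor→fixed M q) ≡ q
      divisor-maps {q} _ (q∣M , 3∤q) with (rep , Js≡s) , back ← divisor→fixed-spec M (4 * n , M≡odd) q q∣M 3∤q =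
        Rep⇒∈cube _ rep′ , (rep′ , Js≡s) , back
        where
        rep′ = subst (λ K → Rep K (divisor→fixed M q)) (sym N≡3M) rep

module MainTheorem where

  open import Data.Nat.Base using (_+_; _*_; parity)
  open import Data.Nat.Properties using (+-cancelʳ-≡; *-cancelˡ-≡; m≤n+m)
  open import Data.Nat.Tactic.RingSolver using (solve-∀)
  open import Data.Parity.Base using (1ℙ)
  open import Data.Product.Base using (_,_)
  open import Data.Sum.Base using (_⊎_)
  open import Function.Bundles using (mk⇔)
  open import Function.Properties.Equivalence using () renaming (sym to ⇔-sym)
  open import Function.Related.Propositional using (module EquationalReasoning; equivalence)
  open import Relation.Binary.PropositionalEquality using (sym; trans; cong; module ≡-Reasoning)
  open import Relation.Nullary.Negation using (¬_)
  open import Relation.Unary.Properties using (_∩?_)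
  open Arithmetic
  open Counting using (count; box)
  open NaturalWindmill using (J)
  open Representations using (_≟³_; cube; rep?; swap; parity-swap; parity-J)
  open PentagonalPairs using (r≡count-symmetric-Rep)
  open DivisorParity using (IsSquare; divisorPrimeTo3?; primeTo3DivisorParity)
  open FixedPoints using (count-fixed-Rep≡count-divisors)

  square-8n+1⇔triangular : ∀ n → IsSquare (8 * n + 1) ⇔ (∃[ m ] n ≡ T m)
  square-8n+1⇔triangular n = mk⇔
    (λ (s , s²≡) → let (t , s≡) = square-odd⇒odd {s} {4 * n} (trans s²≡ (8n+1≡odd n)) in
                    t , *-cancelˡ-≡ n (T t) 8 (+-cancelʳ-≡ 1 _ _ (trans (sym s²≡) (trans (cong (λ w → w * w) s≡) (odd-square t)))))
    (λ (m , n≡Tm) → suc (m + m) , trans (odd-square m) (cong (λ w → 8 * w + 1) (sym n≡Tm)))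
    where
    8n+1≡odd : ∀ n → 8 * n + 1 ≡ suc (4 * n + 4 * n)
    8n+1≡odd = solve-∀

  3*[8n+1]-nonsquare : ∀ n → ¬ IsSquare (3 * (8 * n + 1))
  3*[8n+1]-nonsquare n (s , s²≡) = square≢8*k+3 s (3 * n) (trans s²≡ (regroup n))
    where
    regroup : ∀ n → 3 * (8 * n + 1) ≡ 8 * (3 * n) + 3
    regroup = solve-∀

  module _ (n : ℕ) where

    private
      N = 8 * (3 * n) + 3
      M = 8 * n + 1

    parity-r≡parity-divisorsPrimeTo3 : parity (r n) ≡ parity (count (divisorPrimeTo3? M) (box M))
    parity-r≡parity-divisorsPrimeTo3 = begin
      parity (r n)                                            ≡⟨ cong parity (r≡count-symmetric-Rep n) ⟩
      parity (count (rep? N ∩? λ s → swap s ≟³ s) (cube N))   ≡⟨ parity-swap N ⟨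
      parity (count (rep? N) (cube N))                        ≡⟨ parity-J (3 * n) ⟩
      parity (count (rep? N ∩? λ s → J s ≟³ s) (cube N))      ≡⟨ cong parity (count-fixed-Rep≡count-divisors n) ⟩
      parity (count (divisorPrimeTo3? M) (box M))             ∎
      where open ≡-Reasoning

    r%2≡1⇔triangular : (r n % 2 ≡ 1) ⇔ (∃[ m ] n ≡ T m)
    r%2≡1⇔triangular = begin
      r n % 2 ≡ 1                                        ∼⟨ ⇔-sym (parity≡1ℙ⇔%2≡1 (r n)) ⟩
      parity (r n) ≡ 1ℙ                                  ∼⟨ ≡⇒⇔≡ parity-r≡parity-divisorsPrimeTo3 ⟩
      parity (count (divisorPrimeTo3? M) (box M)) ≡ 1ℙ   ∼⟨ primeTo3DivisorParity M (m≤n+m 1 (8 * n)) ⟩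
      (IsSquare M ⊎ IsSquare (3 * M))                    ∼⟨ ⊎-¬ʳ (3*[8n+1]-nonsquare n) ⟩
      IsSquare M                                         ∼⟨ square-8n+1⇔triangular n ⟩
      (∃[ m ] n ≡ T m)                                   ∎
      where open EquationalReasoning {k = equivalence}

open MainTheorem using (r%2≡1⇔triangular)

corollary1p3 : (n : ℕ) → (r (suc n) % 2 ≡ 1) ⇔ (∃[ m ] suc n ≡ T m)
corollary1p3 n = r%2≡1⇔triangular (suc n)
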